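{- Let $p$ be an odd prime, let $f_a(X)=X^p-X+a\in\mathbb{F}_p[X]$ for $a\in\mathbb{F}_p^\times$, let $f=f_{ -1}=X^p-X-1$, let $e$ be the order of $f$, and let $\ell$ be a prime divisor of $e$. Fix $m\geq 0$. If $f(X^{\ell^m})$ is irreducible over $\mathbb{F}_p$, then each polynomial $f_1(X^{\ell^m}),f_2(X^{\ell^m}),\dots,f_{p-1}(X^{\ell^m})$ is irreducible over $\mathbb{F}_p$.
   Context: The polynomial $X^p-X-1$ is irreducible over $\mathbb{F}_p$; its order $e$ is the multiplicative order of any of its roots in $\mathbb{F}_{p^p}^\times$. (One has $e\mid \frac{p^p-1}{p-1}$ and $\gcd(e,2p(p-1))=1$.) -}

module Defs where

open import Data.Nat using (ℕ; zero; suc; _+_; _*_; _∸_; _^_; _≤_; _<_)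
open import Data.Nat.Divisibility using (_∣_)
open import Data.List using (List; []; _∷_; map; replicate; _++_)
open import Data.Product using (Σ; _×_)
open import Data.Sum using (_⊎_)
open import Relation.Nullary using (¬_)

-- Polynomials over F_p are represented by lists of natural-number
-- coefficients (little-endian: head = constant term), read modulo p.
Poly : Set
Poly = List ℕ

coeff : Poly → ℕ → ℕ
coeff []       _       = 0
coeff (c ∷ f)  zero    = c
coeff (c ∷ f)  (suc i) = coeff f i

-- addition and multiplication of coefficient lists (over ℕ; reduced mod p
-- only through the equivalence below, which is compatible with them)
_⊕_ : Poly → Poly → Poly
[]      ⊕ g       = g
f       ⊕ []      = f
(a ∷ f) ⊕ (b ∷ g) = (a + b) ∷ (f ⊕ g)

_⊛_ : Poly → Poly → Poly
[]      ⊛ g = []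
(a ∷ f) ⊛ g = map (a *_) g ⊕ (0 ∷ (f ⊛ g))

mono : ℕ → ℕ → Poly
mono c k = replicate k 0 ++ (c ∷ [])

_≡_[mod_] : ℕ → ℕ → ℕ → Set
a ≡ b [mod p ] = (p ∣ (a ∸ b)) × (p ∣ (b ∸ a))

_≈[_]_ : Poly → ℕ → Poly → Set
f ≈[ p ] g = ∀ i → coeff f i ≡ coeff g i [mod p ]

-- units of F_p[X] = nonzero constants
IsUnit : ℕ → Poly → Set
IsUnit p g = (¬ (p ∣ coeff g 0)) × (∀ i → 1 ≤ i → p ∣ coeff g i)

Irreducible : ℕ → Poly → Set
Irreducible p f =
  Σ ℕ (λ i → (1 ≤ i) × ¬ (p ∣ coeff f i)) ×
  (∀ g h → f ≈[ p ] (g ⊛ h) → IsUnit p g ⊎ IsUnit p h)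

Divides : ℕ → Poly → Poly → Set
Divides p g f = Σ Poly (λ h → f ≈[ p ] (g ⊛ h))

-- X^n - 1 in F_p[X] (for n ≥ 1), with -1 written as p - 1
XpowMinus1 : ℕ → ℕ → Poly
XpowMinus1 p n = mono (p ∸ 1) 0 ⊕ mono 1 n

IsOrder : ℕ → Poly → ℕ → Set
IsOrder p f e =
  (0 < e) × Divides p f (XpowMinus1 p e) ×
  (∀ e' → 0 < e' → Divides p f (XpowMinus1 p e') → e ≤ e')

-- f_a(X^N) = X^(pN) - X^N + a in F_p[X], with -1 written as p - 1
fSub : ℕ → ℕ → ℕ → Poly
fSub p a N = mono a 0 ⊕ (mono (p ∸ 1) N ⊕ mono 1 (p * N))

-- Write F = Xᵖ - X - 1 and N = ℓᵐ. Modulo F we have Xᵖ ≡ X + 1, so by Frobenius X^(pᵏ) ≡ X + k and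
-- X^(1 + p + ⋯ + pᵖ⁻¹) ≡ X (X + 1) ⋯ (X + p - 1) = Xᵖ - X ≡ 1. Hence the order e divides
-- (pᵖ - 1)/(p - 1), which is ≡ p ≡ 1 modulo every divisor of p - 1, so ℓ ∤ p - 1 and N is invertible
-- modulo p - 1: every t ∈ 𝔽ₚ is an N-th power dᴺ. For t = -a and c = t⁻¹ the substitution
-- f(X) ↦ c·f(dX) sends f_a(X^N) to f₋₁(X^N) and transports factorisations, so the irreducibility
-- of f₋₁(X^N) passes to f_a(X^N).

module Submission where

open import Defs
open import Data.Empty using (⊥-elim)
open import Data.List using ([]; _∷_; map; drop)
open import Data.Nat
open import Data.Nat.Combinatorics
  using (_C_; nCk≡n!/k![n-k]!; k![n∸k]!∣n!; nCn≡1; k>n⇒nCk≡0; nCk+nC[k+1]≡[n+1]C[k+1])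
open import Data.Nat.Coprimality using (Coprime; coprime-Bézout; prime⇒coprime)
import Data.Nat.Coprimality as Coprime
open import Data.Nat.Divisibility
open import Data.Nat.DivMod
open import Data.Nat.GCD using (module Bézout)
open import Data.Nat.Primality
  using (Prime; euclidsLemma; prime⇒irreducible; prime⇒nonZero; prime⇒nonTrivial)
open import Data.Nat.Properties
open import Data.Nat.Tactic.RingSolver using (solve-∀)
open import Data.Product using (Σ; _×_; _,_; proj₁; proj₂)
open import Data.Sum using (_⊎_; inj₁; inj₂)
open import Function using (_∘_)
open import Relation.Binary.Bundles using (Setoid)
open import Relation.Binary.Definitions using (tri<; tri≈; tri>)
open import Relation.Binary.PropositionalEquality
import Relation.Binary.Reasoning.Setoid as SetoidReasoning
open import Relation.Nullary using (¬_; yes; no; Dec)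

module ModularArithmetic (m : ℕ) ⦃ _ : NonZero m ⦄ where

  open ≡-Reasoning

  infix 4 _≅_
  _≅_ : ℕ → ℕ → Set
  a ≅ b = a % m ≡ b % m

  +-≅ : ∀ {a b c d} → a ≅ b → c ≅ d → a + c ≅ b + d
  +-≅ {a} {b} {c} {d} a≅b c≅d = begin
    (a + c) % m           ≡⟨ %-distribˡ-+ a c m ⟩
    (a % m + c % m) % m   ≡⟨ cong₂ (λ x y → (x + y) % m) a≅b c≅d ⟩
    (b % m + d % m) % m   ≡⟨ %-distribˡ-+ b d m ⟨
    (b + d) % m           ∎

  *-≅ : ∀ {a b c d} → a ≅ b → c ≅ d → a * c ≅ b * d
  *-≅ {a} {b} {c} {d} a≅b c≅d = begin
    (a * c) % m             ≡⟨ %-distribˡ-* a c m ⟩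
    (a % m * (c % m)) % m   ≡⟨ cong₂ (λ x y → (x * y) % m) a≅b c≅d ⟩
    (b % m * (d % m)) % m   ≡⟨ %-distribˡ-* b d m ⟨
    (b * d) % m             ∎

  +-≅ˡ : ∀ a {c d} → c ≅ d → a + c ≅ a + d
  +-≅ˡ a = +-≅ {a} {a} refl

  *-≅ˡ : ∀ a {c d} → c ≅ d → a * c ≅ a * d
  *-≅ˡ a = *-≅ {a} {a} refl

  ^-≅ : ∀ {a b} n → a ≅ b → a ^ n ≅ b ^ n
  ^-≅ zero    a≅b = refl
  ^-≅ (suc n) a≅b = *-≅ a≅b (^-≅ n a≅b)

  ∣⇒≅0 : ∀ {a} → m ∣ a → a ≅ 0
  ∣⇒≅0 {a} m∣a = trans (n∣m⇒m%n≡0 a m m∣a) (sym (m*n%n≡0 0 m))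

  ≅0⇒∣ : ∀ {a} → a ≅ 0 → m ∣ a
  ≅0⇒∣ {a} a≅0 = m%n≡0⇒n∣m a m (trans a≅0 (m*n%n≡0 0 m))

  *-modulus≅0 : ∀ a → a * m ≅ 0
  *-modulus≅0 a = ∣⇒≅0 (n∣m*n a)

  +-*-modulus : ∀ a k → a + k * m ≅ a
  +-*-modulus a k = [m+kn]%n≡m%n a k m

  x+[m∸1]*x≡x*m : ∀ x → x + (m ∸ 1) * x ≡ x * m
  x+[m∸1]*x≡x*m x = trans (cong (_* x) (suc-pred m)) (*-comm m x)

  1+[[m∸1]+x]≅x : ∀ x → 1 + ((m ∸ 1) + x) ≅ x
  1+[[m∸1]+x]≅x x = trans (cong (_% m) (trans (sym (+-assoc 1 (m ∸ 1) x)) (cong (_+ x) (suc-pred m))))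
                          (%-remove-+ˡ x ∣-refl)

  +-cancelʳ-≅ : ∀ {a b} c → a + c ≅ b + c → a ≅ b
  +-cancelʳ-≅ {a} {b} c a+c≅b+c = begin
    a % m                           ≡⟨ +-*-modulus a c ⟨
    (a + c * m) % m                 ≡⟨ cong (_% m) (shift a) ⟩
    (a + c + (m ∸ 1) * c) % m       ≡⟨ +-≅ a+c≅b+c (refl {x = ((m ∸ 1) * c) % m}) ⟩
    (b + c + (m ∸ 1) * c) % m       ≡⟨ cong (_% m) (shift b) ⟨
    (b + c * m) % m                 ≡⟨ +-*-modulus b c ⟩
    b % m                           ∎
    where
    shift : ∀ x → x + c * m ≡ x + c + (m ∸ 1) * c
    shift x = trans (cong (x +_) (sym (x+[m∸1]*x≡x*m c))) (sym (+-assoc x c _))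

  -- Subtraction of b is addition of (m ∸ 1) * b.
  ≅⇒+[m∸1]*≅0 : ∀ {a b} → a ≅ b → a + (m ∸ 1) * b ≅ 0
  ≅⇒+[m∸1]*≅0 {a} {b} a≅b = begin
    (a + (m ∸ 1) * b) % m   ≡⟨ +-≅ a≅b (refl {x = ((m ∸ 1) * b) % m}) ⟩
    (b + (m ∸ 1) * b) % m   ≡⟨ cong (_% m) (x+[m∸1]*x≡x*m b) ⟩
    (b * m) % m             ≡⟨ *-modulus≅0 b ⟩
    0 % m                   ∎

  +[m∸1]*≅0⇒≅ : ∀ {a b} → a + (m ∸ 1) * b ≅ 0 → a ≅ b
  +[m∸1]*≅0⇒≅ {a} {b} a-b≅0 = +-cancelʳ-≅ ((m ∸ 1) * b) (begin
    (a + (m ∸ 1) * b) % m   ≡⟨ a-b≅0 ⟩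
    0 % m                   ≡⟨ *-modulus≅0 b ⟨
    (b * m) % m             ≡⟨ cong (_% m) (x+[m∸1]*x≡x*m b) ⟨
    (b + (m ∸ 1) * b) % m   ∎)

  exchange-≅ : ∀ a b c d → a + b ≅ d + c → (m ∸ 1) * d + a ≅ c + (m ∸ 1) * b
  exchange-≅ a b c d a+b≅d+c = +-cancelʳ-≅ (b + d) (trans lhs≅d+c (sym rhs≅d+c))
    where
    P : ℕ
    P = m ∸ 1
    regroupˡ : ∀ P d a b → P * d + a + (b + d) ≡ (a + b) + (d + P * d)
    regroupˡ = solve-∀
    regroupʳ : ∀ P c b d → c + P * b + (b + d) ≡ (d + c) + (b + P * b)
    regroupʳ = solve-∀
    lhs≅d+c : P * d + a + (b + d) ≅ d + c
    lhs≅d+c = trans (cong (_% m) (trans (regroupˡ P d a b) (cong ((a + b) +_) (x+[m∸1]*x≡x*m d))))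
                    (trans (+-*-modulus (a + b) d) a+b≅d+c)
    rhs≅d+c : c + P * b + (b + d) ≅ d + c
    rhs≅d+c = trans (cong (_% m) (trans (regroupʳ P c b d) (cong ((d + c) +_) (x+[m∸1]*x≡x*m b))))
                    (+-*-modulus (d + c) b)

  *-complement≅-1 : ∀ {c t a} → c * t ≅ 1 → t + a ≡ m → c * a ≅ m ∸ 1
  *-complement≅-1 {c} {t} {a} ct≅1 t+a≡m = +-cancelʳ-≅ 1 (begin
    (c * a + 1) % m         ≡⟨ +-≅ˡ (c * a) (sym ct≅1) ⟩
    (c * a + c * t) % m     ≡⟨ cong (_% m) (trans (sym (*-distribˡ-+ c a t)) (cong (c *_) (trans (+-comm a t) t+a≡m))) ⟩
    (c * m) % m             ≡⟨ m*n%n≡0 c m ⟩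
    0                       ≡⟨ n%n≡0 m ⟨
    m % m                   ≡⟨ cong (_% m) (trans (sym (suc-pred m)) (+-comm 1 (m ∸ 1))) ⟩
    (m ∸ 1 + 1) % m         ∎)

  ≅⇒∣∸ : ∀ {a b} → a ≅ b → m ∣ (a ∸ b)
  ≅⇒∣∸ {a} {b} a≅b = divides (a / m ∸ b / m) (begin
    a ∸ b                                        ≡⟨ cong₂ _∸_ (m≡m%n+[m/n]*n a m) (m≡m%n+[m/n]*n b m) ⟩
    (a % m + a / m * m) ∸ (b % m + b / m * m)    ≡⟨ cong (λ r → (a % m + a / m * m) ∸ (r + b / m * m)) a≅b ⟨
    (a % m + a / m * m) ∸ (a % m + b / m * m)    ≡⟨ [m+n]∸[m+o]≡n∸o (a % m) _ _ ⟩
    a / m * m ∸ b / m * m                        ≡⟨ *-distribʳ-∸ m (a / m) (b / m) ⟨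
    (a / m ∸ b / m) * m                          ∎)

  ∣∸⇒≅ : ∀ {a b} → b ≤ a → m ∣ (a ∸ b) → a ≅ b
  ∣∸⇒≅ {a} {b} b≤a m∣a∸b = trans (cong (_% m) (sym (m+[n∸m]≡n b≤a))) (%-remove-+ʳ b m∣a∸b)

  ≅⇒≡[mod] : ∀ {a b} → a ≅ b → a ≡ b [mod m ]
  ≅⇒≡[mod] a≅b = ≅⇒∣∸ a≅b , ≅⇒∣∸ (sym a≅b)

  ≡[mod]⇒≅ : ∀ {a b} → a ≡ b [mod m ] → a ≅ b
  ≡[mod]⇒≅ {a} {b} (m∣a∸b , m∣b∸a) with ≤-total b a
  ... | inj₁ b≤a = ∣∸⇒≅ b≤a m∣a∸b
  ... | inj₂ a≤b = sym (∣∸⇒≅ a≤b m∣b∸a)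

  ≅1⇒≡1+[/]* : 1 < m → ∀ a → a ≅ 1 → a ≡ 1 + (a / m) * m
  ≅1⇒≡1+[/]* 1<m a a≅1 = trans (m≡m%n+[m/n]*n a m) (cong (_+ (a / m) * m) (trans a≅1 (m<n⇒m%n≡m 1<m)))

  ^-inverse : ∀ {u a} n → u * a ≅ 1 → u ^ n * a ^ n ≅ 1
  ^-inverse {u} {a} zero    ua≅1 = refl
  ^-inverse {u} {a} (suc n) ua≅1 = begin
    (u * u ^ n * (a * a ^ n)) % m     ≡⟨ cong (_% m) (interchange u (u ^ n) a (a ^ n)) ⟩
    (u * a * (u ^ n * a ^ n)) % m     ≡⟨ *-≅ ua≅1 (^-inverse n ua≅1) ⟩
    (1 * 1) % m                       ∎
    where
    interchange : ∀ u x a y → u * x * (a * y) ≡ u * a * (x * y)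
    interchange = solve-∀

  coprime⇒invertible : ∀ {a} → Coprime a m → Σ ℕ (λ u → u * a ≅ 1)
  coprime⇒invertible {a} coprime with coprime-Bézout coprime
  ... | Bézout.+- x y 1+ym≡xa = x , (begin
    (x * a) % m       ≡⟨ cong (_% m) 1+ym≡xa ⟨
    (1 + y * m) % m   ≡⟨ +-*-modulus 1 y ⟩
    1 % m             ∎)
  ... | Bézout.-+ x y 1+xa≡ym = x * (m ∸ 1) , +-cancelʳ-≅ (m ∸ 1) (begin
    (x * (m ∸ 1) * a + (m ∸ 1)) % m   ≡⟨ cong (_% m) (factor x (m ∸ 1) a) ⟩
    ((m ∸ 1) * (1 + x * a)) % m       ≡⟨ cong (λ r → ((m ∸ 1) * r) % m) 1+xa≡ym ⟩
    ((m ∸ 1) * (y * m)) % m           ≡⟨ cong (_% m) (*-assoc (m ∸ 1) y m) ⟨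
    ((m ∸ 1) * y * m) % m             ≡⟨ m*n%n≡0 ((m ∸ 1) * y) m ⟩
    0                                 ≡⟨ n%n≡0 m ⟨
    m % m                             ≡⟨ cong (_% m) (suc-pred m) ⟨
    (1 + (m ∸ 1)) % m                 ∎)
    where
    factor : ∀ x k a → x * k * a + k ≡ k * (1 + x * a)
    factor = solve-∀

module CoefficientLists where

  open ≡-Reasoning

  infix 4 _≋_
  record _≋_ (f g : Poly) : Set where
    constructor mk≋
    field at : ∀ i → coeff f i ≡ coeff g i
  open _≋_ public

  ≋-refl : ∀ {f} → f ≋ f
  ≋-refl .at i = refl

  ≋-sym : ∀ {f g} → f ≋ g → g ≋ f
  ≋-sym f≋g .at i = sym (f≋g .at i)

  ≋-trans : ∀ {f g h} → f ≋ g → g ≋ h → f ≋ h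
  ≋-trans f≋g g≋h .at i = trans (f≋g .at i) (g≋h .at i)

  ∷-≋ : ∀ {a b f g} → a ≡ b → f ≋ g → (a ∷ f) ≋ (b ∷ g)
  ∷-≋ a≡b f≋g .at zero    = a≡b
  ∷-≋ a≡b f≋g .at (suc i) = f≋g .at i

  ≋-tail : ∀ {a b f g} → (a ∷ f) ≋ (b ∷ g) → f ≋ g
  ≋-tail a∷f≋b∷g .at i = a∷f≋b∷g .at (suc i)

  coeff-⊕ : ∀ f g i → coeff (f ⊕ g) i ≡ coeff f i + coeff g i
  coeff-⊕ []      g       i       = refl
  coeff-⊕ (a ∷ f) []      i       = sym (+-identityʳ _)
  coeff-⊕ (a ∷ f) (b ∷ g) zero    = refl
  coeff-⊕ (a ∷ f) (b ∷ g) (suc i) = coeff-⊕ f g i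

  coeff-map : ∀ a f i → coeff (map (a *_) f) i ≡ a * coeff f i
  coeff-map a []      i       = sym (*-zeroʳ a)
  coeff-map a (x ∷ f) zero    = refl
  coeff-map a (x ∷ f) (suc i) = coeff-map a f i

  coeff-∷-⊛ : ∀ a f g i → coeff ((a ∷ f) ⊛ g) i ≡ a * coeff g i + coeff (0 ∷ (f ⊛ g)) i
  coeff-∷-⊛ a f g i =
    trans (coeff-⊕ (map (a *_) g) (0 ∷ (f ⊛ g)) i) (cong (_+ coeff (0 ∷ (f ⊛ g)) i) (coeff-map a g i))

  ⊕-cong : ∀ {f f' g g'} → f ≋ f' → g ≋ g' → (f ⊕ g) ≋ (f' ⊕ g')
  ⊕-cong {f} {f'} {g} {g'} f≋f' g≋g' .at i =
    trans (coeff-⊕ f g i) (trans (cong₂ _+_ (f≋f' .at i) (g≋g' .at i)) (sym (coeff-⊕ f' g' i)))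

  ⊕-congˡ : ∀ f {g g'} → g ≋ g' → (f ⊕ g) ≋ (f ⊕ g')
  ⊕-congˡ f = ⊕-cong {f} ≋-refl

  ⊕-comm : ∀ f g → (f ⊕ g) ≋ (g ⊕ f)
  ⊕-comm f g .at i = trans (coeff-⊕ f g i) (trans (+-comm (coeff f i) (coeff g i)) (sym (coeff-⊕ g f i)))

  ⊕-assoc : ∀ f g h → ((f ⊕ g) ⊕ h) ≋ (f ⊕ (g ⊕ h))
  ⊕-assoc f g h .at i = begin
    coeff ((f ⊕ g) ⊕ h) i                ≡⟨ coeff-⊕ (f ⊕ g) h i ⟩
    coeff (f ⊕ g) i + coeff h i          ≡⟨ cong (_+ coeff h i) (coeff-⊕ f g i) ⟩
    coeff f i + coeff g i + coeff h i    ≡⟨ +-assoc (coeff f i) _ _ ⟩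
    coeff f i + (coeff g i + coeff h i)  ≡⟨ cong (coeff f i +_) (coeff-⊕ g h i) ⟨
    coeff f i + coeff (g ⊕ h) i          ≡⟨ coeff-⊕ f (g ⊕ h) i ⟨
    coeff (f ⊕ (g ⊕ h)) i                ∎

  ⊕-identityʳ : ∀ f → (f ⊕ []) ≋ f
  ⊕-identityʳ f .at i = trans (coeff-⊕ f [] i) (+-identityʳ _)

  map-cong : ∀ a {f g} → f ≋ g → map (a *_) f ≋ map (a *_) g
  map-cong a {f} {g} f≋g .at i =
    trans (coeff-map a f i) (trans (cong (a *_) (f≋g .at i)) (sym (coeff-map a g i)))

  map-⊕ : ∀ a f g → map (a *_) (f ⊕ g) ≋ (map (a *_) f ⊕ map (a *_) g)
  map-⊕ a f g .at i = begin
    coeff (map (a *_) (f ⊕ g)) i                     ≡⟨ coeff-map a (f ⊕ g) i ⟩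
    a * coeff (f ⊕ g) i                              ≡⟨ cong (a *_) (coeff-⊕ f g i) ⟩
    a * (coeff f i + coeff g i)                      ≡⟨ *-distribˡ-+ a _ _ ⟩
    a * coeff f i + a * coeff g i                    ≡⟨ cong₂ _+_ (coeff-map a f i) (coeff-map a g i) ⟨
    coeff (map (a *_) f) i + coeff (map (a *_) g) i  ≡⟨ coeff-⊕ (map (a *_) f) _ i ⟨
    coeff (map (a *_) f ⊕ map (a *_) g) i            ∎

  map-1 : ∀ f → map (1 *_) f ≋ f
  map-1 f .at i = trans (coeff-map 1 f i) (*-identityˡ _)

  ⊛-zeroʳ : ∀ f → (f ⊛ []) ≋ []
  ⊛-zeroʳ []      .at i       = refl
  ⊛-zeroʳ (a ∷ f) .at zero    = refl
  ⊛-zeroʳ (a ∷ f) .at (suc i) = ⊛-zeroʳ f .at i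

  ≋[]⇒⊛≋[] : ∀ f g → f ≋ [] → (f ⊛ g) ≋ []
  ≋[]⇒⊛≋[] []      g f≋[] .at i = refl
  ≋[]⇒⊛≋[] (a ∷ f) g f≋[] .at i = trans (coeff-∷-⊛ a f g i) (coeff≡0 i)
    where
    coeff≡0 : ∀ i → a * coeff g i + coeff (0 ∷ (f ⊛ g)) i ≡ 0
    coeff≡0 zero    rewrite f≋[] .at zero = refl
    coeff≡0 (suc i) rewrite f≋[] .at zero = ≋[]⇒⊛≋[] f g (mk≋ λ j → f≋[] .at (suc j)) .at i

  ⊛-congˡ : ∀ {f f'} g → f ≋ f' → (f ⊛ g) ≋ (f' ⊛ g)
  ⊛-congˡ {[]}    {[]}     g f≋f' = ≋-refl
  ⊛-congˡ {[]}    {b ∷ f'} g f≋f' = ≋-sym (≋[]⇒⊛≋[] (b ∷ f') g (≋-sym f≋f'))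
  ⊛-congˡ {a ∷ f} {[]}     g f≋f' = ≋[]⇒⊛≋[] (a ∷ f) g f≋f'
  ⊛-congˡ {a ∷ f} {b ∷ f'} g f≋f' .at i = begin
    coeff ((a ∷ f) ⊛ g) i                  ≡⟨ coeff-∷-⊛ a f g i ⟩
    a * coeff g i + coeff (0 ∷ (f ⊛ g)) i  ≡⟨ cong₂ (λ x y → x * coeff g i + y) (f≋f' .at zero) (tail .at i) ⟩
    b * coeff g i + coeff (0 ∷ (f' ⊛ g)) i ≡⟨ coeff-∷-⊛ b f' g i ⟨
    coeff ((b ∷ f') ⊛ g) i                 ∎
    where
    tail : (0 ∷ (f ⊛ g)) ≋ (0 ∷ (f' ⊛ g))
    tail = ∷-≋ refl (⊛-congˡ g (≋-tail f≋f'))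

  ⊛-congʳ : ∀ f {g g'} → g ≋ g' → (f ⊛ g) ≋ (f ⊛ g')
  ⊛-congʳ []      g≋g' = ≋-refl
  ⊛-congʳ (a ∷ f) g≋g' = ⊕-cong (map-cong a g≋g') (∷-≋ refl (⊛-congʳ f g≋g'))

  ⊛-distribʳ : ∀ f g h → ((f ⊕ g) ⊛ h) ≋ ((f ⊛ h) ⊕ (g ⊛ h))
  ⊛-distribʳ []      g       h = ≋-refl
  ⊛-distribʳ (a ∷ f) []      h = ≋-sym (⊕-identityʳ _)
  ⊛-distribʳ (a ∷ f) (b ∷ g) h .at i = begin
    coeff (((a + b) ∷ (f ⊕ g)) ⊛ h) i
      ≡⟨ coeff-∷-⊛ (a + b) (f ⊕ g) h i ⟩
    (a + b) * coeff h i + coeff (0 ∷ ((f ⊕ g) ⊛ h)) i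
      ≡⟨ cong ((a + b) * coeff h i +_) (∷-≋ refl (⊛-distribʳ f g h) .at i) ⟩
    (a + b) * coeff h i + coeff (0 ∷ ((f ⊛ h) ⊕ (g ⊛ h))) i
      ≡⟨ regroup i ⟩
    (a * coeff h i + coeff (0 ∷ (f ⊛ h)) i) + (b * coeff h i + coeff (0 ∷ (g ⊛ h)) i)
      ≡⟨ cong₂ _+_ (coeff-∷-⊛ a f h i) (coeff-∷-⊛ b g h i) ⟨
    coeff ((a ∷ f) ⊛ h) i + coeff ((b ∷ g) ⊛ h) i
      ≡⟨ coeff-⊕ ((a ∷ f) ⊛ h) _ i ⟨
    coeff (((a ∷ f) ⊛ h) ⊕ ((b ∷ g) ⊛ h)) i
      ∎
    where
    distrib : ∀ a b x y z → (a + b) * x + (y + z) ≡ (a * x + y) + (b * x + z)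
    distrib = solve-∀
    regroup : ∀ i → (a + b) * coeff h i + coeff (0 ∷ ((f ⊛ h) ⊕ (g ⊛ h))) i
                  ≡ (a * coeff h i + coeff (0 ∷ (f ⊛ h)) i) + (b * coeff h i + coeff (0 ∷ (g ⊛ h)) i)
    regroup zero    = distrib a b (coeff h 0) 0 0
    regroup (suc i) = trans (cong ((a + b) * coeff h (suc i) +_) (coeff-⊕ (f ⊛ h) (g ⊛ h) i)) (distrib a b _ _ _)

  ⊛-distribˡ : ∀ f g h → (f ⊛ (g ⊕ h)) ≋ ((f ⊛ g) ⊕ (f ⊛ h))
  ⊛-distribˡ []      g h = ≋-refl
  ⊛-distribˡ (a ∷ f) g h .at i = begin
    coeff ((a ∷ f) ⊛ (g ⊕ h)) i
      ≡⟨ coeff-∷-⊛ a f (g ⊕ h) i ⟩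
    a * coeff (g ⊕ h) i + coeff (0 ∷ (f ⊛ (g ⊕ h))) i
      ≡⟨ cong₂ _+_ (cong (a *_) (coeff-⊕ g h i)) (∷-≋ refl (⊛-distribˡ f g h) .at i) ⟩
    a * (coeff g i + coeff h i) + coeff (0 ∷ ((f ⊛ g) ⊕ (f ⊛ h))) i
      ≡⟨ regroup i ⟩
    (a * coeff g i + coeff (0 ∷ (f ⊛ g)) i) + (a * coeff h i + coeff (0 ∷ (f ⊛ h)) i)
      ≡⟨ cong₂ _+_ (coeff-∷-⊛ a f g i) (coeff-∷-⊛ a f h i) ⟨
    coeff ((a ∷ f) ⊛ g) i + coeff ((a ∷ f) ⊛ h) i
      ≡⟨ coeff-⊕ ((a ∷ f) ⊛ g) _ i ⟨
    coeff (((a ∷ f) ⊛ g) ⊕ ((a ∷ f) ⊛ h)) i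
      ∎
    where
    distrib : ∀ a x w y z → a * (x + w) + (y + z) ≡ (a * x + y) + (a * w + z)
    distrib = solve-∀
    regroup : ∀ i → a * (coeff g i + coeff h i) + coeff (0 ∷ ((f ⊛ g) ⊕ (f ⊛ h))) i
                  ≡ (a * coeff g i + coeff (0 ∷ (f ⊛ g)) i) + (a * coeff h i + coeff (0 ∷ (f ⊛ h)) i)
    regroup zero    = distrib a _ _ 0 0
    regroup (suc i) =
      trans (cong (a * (coeff g (suc i) + coeff h (suc i)) +_) (coeff-⊕ (f ⊛ g) (f ⊛ h) i)) (distrib a _ _ _ _)

  ⊛-mapˡ : ∀ c f g → ((map (c *_) f) ⊛ g) ≋ map (c *_) (f ⊛ g)
  ⊛-mapˡ c []      g = ≋-refl
  ⊛-mapˡ c (a ∷ f) g .at i = begin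
    coeff ((c * a ∷ map (c *_) f) ⊛ g) i
      ≡⟨ coeff-∷-⊛ (c * a) (map (c *_) f) g i ⟩
    c * a * coeff g i + coeff (0 ∷ (map (c *_) f ⊛ g)) i
      ≡⟨ cong (c * a * coeff g i +_) (∷-≋ refl (⊛-mapˡ c f g) .at i) ⟩
    c * a * coeff g i + coeff (0 ∷ map (c *_) (f ⊛ g)) i
      ≡⟨ factor i ⟩
    c * (a * coeff g i + coeff (0 ∷ (f ⊛ g)) i)
      ≡⟨ cong (c *_) (coeff-∷-⊛ a f g i) ⟨
    c * coeff ((a ∷ f) ⊛ g) i
      ≡⟨ coeff-map c ((a ∷ f) ⊛ g) i ⟨
    coeff (map (c *_) ((a ∷ f) ⊛ g)) i
      ∎
    where
    distrib : ∀ c a x y → c * a * x + c * y ≡ c * (a * x + y)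
    distrib = solve-∀
    factor : ∀ i → c * a * coeff g i + coeff (0 ∷ map (c *_) (f ⊛ g)) i ≡ c * (a * coeff g i + coeff (0 ∷ (f ⊛ g)) i)
    factor zero    = trans (cong (c * a * coeff g 0 +_) (sym (*-zeroʳ c))) (distrib c a _ 0)
    factor (suc i) = trans (cong (c * a * coeff g (suc i) +_) (coeff-map c (f ⊛ g) i)) (distrib c a _ _)

  ⊛-∷ʳ : ∀ f b g → (f ⊛ (b ∷ g)) ≋ (map (b *_) f ⊕ (0 ∷ (f ⊛ g)))
  ⊛-∷ʳ []      b g .at zero    = refl
  ⊛-∷ʳ []      b g .at (suc i) = refl
  ⊛-∷ʳ (a ∷ f) b g .at zero    = trans (+-identityʳ _) (trans (*-comm a b) (sym (+-identityʳ _)))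
  ⊛-∷ʳ (a ∷ f) b g .at (suc i) = begin
    coeff (map (a *_) g ⊕ (f ⊛ (b ∷ g))) i
      ≡⟨ coeff-⊕ (map (a *_) g) _ i ⟩
    coeff (map (a *_) g) i + coeff (f ⊛ (b ∷ g)) i
      ≡⟨ cong (coeff (map (a *_) g) i +_) (trans (⊛-∷ʳ f b g .at i) (coeff-⊕ (map (b *_) f) _ i)) ⟩
    coeff (map (a *_) g) i + (coeff (map (b *_) f) i + coeff (0 ∷ (f ⊛ g)) i)
      ≡⟨ +-exchange (coeff (map (a *_) g) i) (coeff (map (b *_) f) i) (coeff (0 ∷ (f ⊛ g)) i) ⟩
    coeff (map (b *_) f) i + (coeff (map (a *_) g) i + coeff (0 ∷ (f ⊛ g)) i)
      ≡⟨ cong (coeff (map (b *_) f) i +_) (coeff-⊕ (map (a *_) g) _ i) ⟨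
    coeff (map (b *_) f) i + coeff ((a ∷ f) ⊛ g) i
      ≡⟨ coeff-⊕ (map (b *_) f) _ i ⟨
    coeff (map (b *_) f ⊕ ((a ∷ f) ⊛ g)) i
      ∎
    where
    +-exchange : ∀ x y z → x + (y + z) ≡ y + (x + z)
    +-exchange = solve-∀

  ⊛-comm : ∀ f g → (f ⊛ g) ≋ (g ⊛ f)
  ⊛-comm []      g = ≋-sym (⊛-zeroʳ g)
  ⊛-comm (a ∷ f) g = ≋-trans (⊕-congˡ (map (a *_) g) (∷-≋ refl (⊛-comm f g))) (≋-sym (⊛-∷ʳ g a f))

  ⊛-mapʳ : ∀ c f g → (f ⊛ (map (c *_) g)) ≋ map (c *_) (f ⊛ g)
  ⊛-mapʳ c f g = ≋-trans (⊛-comm f _) (≋-trans (⊛-mapˡ c g f) (map-cong c (⊛-comm g f)))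

  ⊛-assoc : ∀ f g h → ((f ⊛ g) ⊛ h) ≋ (f ⊛ (g ⊛ h))
  ⊛-assoc []      g h = ≋-refl
  ⊛-assoc (a ∷ f) g h =
    ≋-trans (⊛-distribʳ (map (a *_) g) (0 ∷ (f ⊛ g)) h)
            (⊕-cong (⊛-mapˡ a g h) (≋-trans (mk≋ (coeff-∷-⊛ 0 (f ⊛ g) h)) (∷-≋ refl (⊛-assoc f g h))))

  one : Poly
  one = 1 ∷ []

  ⊛-identityˡ : ∀ g → (one ⊛ g) ≋ g
  ⊛-identityˡ g .at i = trans (coeff-∷-⊛ 1 [] g i) (coeff-≡ i)
    where
    coeff-≡ : ∀ i → 1 * coeff g i + coeff (0 ∷ []) i ≡ coeff g i
    coeff-≡ zero    = trans (+-identityʳ _) (*-identityˡ _)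
    coeff-≡ (suc i) = trans (+-identityʳ _) (*-identityˡ _)

  ⊛-identityʳ : ∀ g → (g ⊛ one) ≋ g
  ⊛-identityʳ g = ≋-trans (⊛-comm g one) (⊛-identityˡ g)

  pow : Poly → ℕ → Poly
  pow g zero    = one
  pow g (suc n) = g ⊛ pow g n

  pow-+ : ∀ g m n → pow g (m + n) ≋ (pow g m ⊛ pow g n)
  pow-+ g zero    n = ≋-sym (⊛-identityˡ (pow g n))
  pow-+ g (suc m) n = ≋-trans (⊛-congʳ g (pow-+ g m n)) (≋-sym (⊛-assoc g (pow g m) (pow g n)))

  pow-* : ∀ g n m → pow g (n * m) ≋ pow (pow g m) n
  pow-* g zero    m = ≋-refl
  pow-* g (suc n) m = ≋-trans (pow-+ g m (n * m)) (⊛-congʳ (pow g m) (pow-* g n m))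

  pow-one : ∀ n → pow one n ≋ one
  pow-one zero    = ≋-refl
  pow-one (suc n) = ≋-trans (⊛-identityˡ (pow one n)) (pow-one n)

  X : Poly
  X = 0 ∷ 1 ∷ []

  infix 8 X+_
  X+_ : ℕ → Poly
  X+ s = s ∷ 1 ∷ []

  coeff-X+-⊛ : ∀ s q i → coeff ((X+ s) ⊛ q) i ≡ s * coeff q i + coeff (0 ∷ q) i
  coeff-X+-⊛ s q i = trans (coeff-∷-⊛ s (1 ∷ []) q i) (cong (s * coeff q i +_) (shift-≡ i))
    where
    shift-≡ : ∀ i → coeff (0 ∷ (one ⊛ q)) i ≡ coeff (0 ∷ q) i
    shift-≡ zero    = refl
    shift-≡ (suc i) = ⊛-identityˡ q .at i

  mono1≋powX : ∀ n → mono 1 n ≋ pow X n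
  mono1≋powX zero    = ≋-refl
  mono1≋powX (suc n) = ≋-trans (∷-≋ refl (mono1≋powX n)) (≋-sym (mk≋ (coeff-X+-⊛ 0 (pow X n))))

  coeff-mono-≡ : ∀ c k → coeff (mono c k) k ≡ c
  coeff-mono-≡ c zero    = refl
  coeff-mono-≡ c (suc k) = coeff-mono-≡ c k

  coeff-mono-≢ : ∀ c k i → i ≢ k → coeff (mono c k) i ≡ 0
  coeff-mono-≢ c zero    zero    i≢k = ⊥-elim (i≢k refl)
  coeff-mono-≢ c zero    (suc i) i≢k = refl
  coeff-mono-≢ c (suc k) zero    i≢k = refl
  coeff-mono-≢ c (suc k) (suc i) i≢k = coeff-mono-≢ c k i (i≢k ∘ cong suc)

  eval : ℕ → Poly → ℕ
  eval r []      = 0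
  eval r (c ∷ f) = c + r * eval r f

  eval-⊕ : ∀ r f g → eval r (f ⊕ g) ≡ eval r f + eval r g
  eval-⊕ r []      g       = refl
  eval-⊕ r (a ∷ f) []      = sym (+-identityʳ _)
  eval-⊕ r (a ∷ f) (b ∷ g) = trans (cong (λ z → a + b + r * z) (eval-⊕ r f g)) (distrib a b r (eval r f) (eval r g))
    where
    distrib : ∀ a b r x y → a + b + r * (x + y) ≡ a + r * x + (b + r * y)
    distrib = solve-∀

  eval-map : ∀ r a f → eval r (map (a *_) f) ≡ a * eval r f
  eval-map r a []      = sym (*-zeroʳ a)
  eval-map r a (c ∷ f) = trans (cong (λ z → a * c + r * z) (eval-map r a f)) (distrib a c r (eval r f))
    where
    distrib : ∀ a c r x → a * c + r * (a * x) ≡ a * (c + r * x)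
    distrib = solve-∀

  eval-⊛ : ∀ r f g → eval r (f ⊛ g) ≡ eval r f * eval r g
  eval-⊛ r []      g = refl
  eval-⊛ r (a ∷ f) g = begin
    eval r (map (a *_) g ⊕ (0 ∷ (f ⊛ g)))              ≡⟨ eval-⊕ r (map (a *_) g) (0 ∷ (f ⊛ g)) ⟩
    eval r (map (a *_) g) + (0 + r * eval r (f ⊛ g))   ≡⟨ cong₂ (λ x y → x + (0 + r * y)) (eval-map r a g) (eval-⊛ r f g) ⟩
    a * eval r g + (0 + r * (eval r f * eval r g))     ≡⟨ distrib a r (eval r f) (eval r g) ⟩
    (a + r * eval r f) * eval r g                      ∎
    where
    distrib : ∀ a r x y → a * y + (0 + r * (x * y)) ≡ (a + r * x) * y
    distrib = solve-∀

  eval-pow : ∀ r g n → eval r (pow g n) ≡ eval r g ^ n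
  eval-pow r g zero    = cong suc (*-zeroʳ r)
  eval-pow r g (suc n) = trans (eval-⊛ r g (pow g n)) (cong (eval r g *_) (eval-pow r g n))

  eval-X+ : ∀ r s → eval r (X+ s) ≡ s + r
  eval-X+ r s = cong (s +_) (trans (cong (λ z → r * suc z) (*-zeroʳ r)) (*-identityʳ r))

  eval-mono : ∀ r c k → eval r (mono c k) ≡ c * r ^ k
  eval-mono r c zero    = trans (cong (c +_) (*-zeroʳ r)) (trans (+-identityʳ c) (sym (*-identityʳ c)))
  eval-mono r c (suc k) = trans (cong (r *_) (eval-mono r c k)) (x*[c*y]≡c*[x*y] r c (r ^ k))
    where
    x*[c*y]≡c*[x*y] : ∀ x c y → x * (c * y) ≡ c * (x * y)
    x*[c*y]≡c*[x*y] = solve-∀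

module Residues (p : ℕ) ⦃ _ : NonZero p ⦄ where

  open ModularArithmetic p public
  open CoefficientLists

  infix 4 _≈_
  record _≈_ (f g : Poly) : Set where
    constructor mk≈
    field at≈ : ∀ i → coeff f i ≅ coeff g i
  open _≈_ public

  ≈-refl : ∀ {f} → f ≈ f
  ≈-refl .at≈ i = refl

  ≈-sym : ∀ {f g} → f ≈ g → g ≈ f
  ≈-sym f≈g .at≈ i = sym (f≈g .at≈ i)

  ≈-trans : ∀ {f g h} → f ≈ g → g ≈ h → f ≈ h
  ≈-trans f≈g g≈h .at≈ i = trans (f≈g .at≈ i) (g≈h .at≈ i)

  ≈-setoid : Setoid _ _
  ≈-setoid = record
    { Carrier = Poly ; _≈_ = _≈_
    ; isEquivalence = record { refl = ≈-refl ; sym = ≈-sym ; trans = ≈-trans } }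

  ≋⇒≈ : ∀ {f g} → f ≋ g → f ≈ g
  ≋⇒≈ f≋g .at≈ i = cong (_% p) (f≋g .at i)

  ≈[]⇒≈ : ∀ {f g} → f ≈[ p ] g → f ≈ g
  ≈[]⇒≈ f≈g .at≈ i = ≡[mod]⇒≅ (f≈g i)

  ≈⇒≈[] : ∀ {f g} → f ≈ g → f ≈[ p ] g
  ≈⇒≈[] f≈g i = ≅⇒≡[mod] (f≈g .at≈ i)

  ∷-≈ : ∀ {a b f g} → a ≅ b → f ≈ g → (a ∷ f) ≈ (b ∷ g)
  ∷-≈ a≅b f≈g .at≈ zero    = a≅b
  ∷-≈ a≅b f≈g .at≈ (suc i) = f≈g .at≈ i

  ≈-tail : ∀ {a b f g} → (a ∷ f) ≈ (b ∷ g) → f ≈ g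
  ≈-tail a∷f≈b∷g .at≈ i = a∷f≈b∷g .at≈ (suc i)

  ⊕-cong≈ : ∀ {f f' g g'} → f ≈ f' → g ≈ g' → (f ⊕ g) ≈ (f' ⊕ g')
  ⊕-cong≈ {f} {f'} {g} {g'} f≈f' g≈g' .at≈ i = begin
    coeff (f ⊕ g) i % p              ≡⟨ cong (_% p) (coeff-⊕ f g i) ⟩
    (coeff f i + coeff g i) % p      ≡⟨ +-≅ (f≈f' .at≈ i) (g≈g' .at≈ i) ⟩
    (coeff f' i + coeff g' i) % p    ≡⟨ cong (_% p) (coeff-⊕ f' g' i) ⟨
    coeff (f' ⊕ g') i % p            ∎
    where open ≡-Reasoning

  map-cong≈ : ∀ a {f g} → f ≈ g → map (a *_) f ≈ map (a *_) g
  map-cong≈ a {f} {g} f≈g .at≈ i = begin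
    coeff (map (a *_) f) i % p   ≡⟨ cong (_% p) (coeff-map a f i) ⟩
    (a * coeff f i) % p          ≡⟨ *-≅ˡ a (f≈g .at≈ i) ⟩
    (a * coeff g i) % p          ≡⟨ cong (_% p) (coeff-map a g i) ⟨
    coeff (map (a *_) g) i % p   ∎
    where open ≡-Reasoning

  ≈[]⇒⊛≈[] : ∀ f g → f ≈ [] → (f ⊛ g) ≈ []
  ≈[]⇒⊛≈[] []      g f≈[] .at≈ i = refl
  ≈[]⇒⊛≈[] (a ∷ f) g f≈[] .at≈ i = trans (cong (_% p) (coeff-∷-⊛ a f g i)) (coeff≅0 i)
    where
    a*≅0 : ∀ x → a * x ≅ 0
    a*≅0 x = *-≅ {a} {0} {x} {x} (f≈[] .at≈ zero) refl
    coeff≅0 : ∀ i → a * coeff g i + coeff (0 ∷ (f ⊛ g)) i ≅ 0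
    coeff≅0 zero    = +-≅ (a*≅0 (coeff g 0)) refl
    coeff≅0 (suc i) = +-≅ (a*≅0 (coeff g (suc i))) (≈[]⇒⊛≈[] f g (mk≈ λ j → f≈[] .at≈ (suc j)) .at≈ i)

  ⊛-congˡ≈ : ∀ {f f'} g → f ≈ f' → (f ⊛ g) ≈ (f' ⊛ g)
  ⊛-congˡ≈ {[]}    {[]}     g f≈f' = ≈-refl
  ⊛-congˡ≈ {[]}    {b ∷ f'} g f≈f' = ≈-sym (≈[]⇒⊛≈[] (b ∷ f') g (≈-sym f≈f'))
  ⊛-congˡ≈ {a ∷ f} {[]}     g f≈f' = ≈[]⇒⊛≈[] (a ∷ f) g f≈f'
  ⊛-congˡ≈ {a ∷ f} {b ∷ f'} g f≈f' .at≈ i = begin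
    coeff ((a ∷ f) ⊛ g) i % p                     ≡⟨ cong (_% p) (coeff-∷-⊛ a f g i) ⟩
    (a * coeff g i + coeff (0 ∷ (f ⊛ g)) i) % p   ≡⟨ +-≅ (*-≅ (f≈f' .at≈ zero) refl) (tail .at≈ i) ⟩
    (b * coeff g i + coeff (0 ∷ (f' ⊛ g)) i) % p  ≡⟨ cong (_% p) (coeff-∷-⊛ b f' g i) ⟨
    coeff ((b ∷ f') ⊛ g) i % p                    ∎
    where
    open ≡-Reasoning
    tail : (0 ∷ (f ⊛ g)) ≈ (0 ∷ (f' ⊛ g))
    tail = ∷-≈ refl (⊛-congˡ≈ g (≈-tail f≈f'))

  ⊛-congʳ≈ : ∀ f {g g'} → g ≈ g' → (f ⊛ g) ≈ (f ⊛ g')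
  ⊛-congʳ≈ []      g≈g' = ≈-refl
  ⊛-congʳ≈ (a ∷ f) g≈g' = ⊕-cong≈ (map-cong≈ a g≈g') (∷-≈ refl (⊛-congʳ≈ f g≈g'))

  eval-≈[] : ∀ r f → f ≈ [] → eval r f ≅ 0
  eval-≈[] r []      f≈[] = refl
  eval-≈[] r (c ∷ f) f≈[] =
    trans (+-≅ (f≈[] .at≈ zero) (*-≅ˡ r (eval-≈[] r f (mk≈ λ j → f≈[] .at≈ (suc j))))) (cong (_% p) (*-zeroʳ r))

  eval-≈ : ∀ r {f g} → f ≈ g → eval r f ≅ eval r g
  eval-≈ r {[]}    {[]}    f≈g = refl
  eval-≈ r {[]}    {b ∷ g} f≈g = sym (eval-≈[] r (b ∷ g) (≈-sym f≈g))
  eval-≈ r {a ∷ f} {[]}    f≈g = eval-≈[] r (a ∷ f) f≈g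
  eval-≈ r {a ∷ f} {b ∷ g} f≈g = +-≅ (f≈g .at≈ zero) (*-≅ˡ r (eval-≈ r (≈-tail f≈g)))

module PrimeField (p : ℕ) (p-prime : Prime p) where

  instance
    p≢0 : NonZero p
    p≢0 = prime⇒nonZero p-prime

  open CoefficientLists
  open Residues p public

  1<p : 1 < p
  1<p = nonTrivial⇒n>1 p ⦃ prime⇒nonTrivial p-prime ⦄

  p∤0<n<p : ∀ {n} → 0 < n → n < p → ¬ (p ∣ n)
  p∤0<n<p {suc n} _ n<p p∣n = <⇒≱ n<p (∣⇒≤ p∣n)

  p∤1 : ¬ (p ∣ 1)
  p∤1 = p∤0<n<p z<s 1<p

  *≅0⇒≅0 : ∀ a b → a * b ≅ 0 → ¬ (p ∣ a) → b ≅ 0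
  *≅0⇒≅0 a b ab≅0 p∤a with euclidsLemma a b p-prime (≅0⇒∣ ab≅0)
  ... | inj₁ p∣a = ⊥-elim (p∤a p∣a)
  ... | inj₂ p∣b = ∣⇒≅0 p∣b

  quotientBy : ℕ → Poly → Poly
  quotientBy r []      = []
  quotientBy r (c ∷ g) = eval r g ∷ quotientBy r g

  coeff-quotientBy : ∀ r g i → coeff (quotientBy r g) i ≡ eval r (drop (suc i) g)
  coeff-quotientBy r []      i       = refl
  coeff-quotientBy r (c ∷ g) zero    = refl
  coeff-quotientBy r (c ∷ g) (suc i) = coeff-quotientBy r g i

  eval-drop : ∀ r g i → eval r (drop i g) ≡ coeff g i + r * eval r (drop (suc i) g)
  eval-drop r []      zero    = sym (*-zeroʳ r)
  eval-drop r []      (suc i) = sym (*-zeroʳ r)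
  eval-drop r (c ∷ g) zero    = refl
  eval-drop r (c ∷ g) (suc i) = eval-drop r g i

  coeff-drop : ∀ k g j → coeff (drop k g) j ≡ coeff g (k + j)
  coeff-drop zero    g       j = refl
  coeff-drop (suc k) []      j = refl
  coeff-drop (suc k) (c ∷ g) j = coeff-drop k g j

  -- Division by X - r, written X + s with s + r = p; the remainder is g(r).
  division : ∀ r s → s + r ≡ p → ∀ g → g ≈ (((X+ s) ⊛ quotientBy r g) ⊕ (eval r g ∷ []))
  division r s s+r≡p g .at≈ i =
    sym (trans (cong (_% p) (coeff-⊕ ((X+ s) ⊛ quotientBy r g) (eval r g ∷ []) i)) (coeff-≅ i))
    where
    D : ℕ → ℕ
    D i = eval r (drop i g)
    collect : ∀ s r c d → s * d + (c + r * d) ≡ c + d * (s + r)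
    collect = solve-∀
    step : ∀ i → s * D (suc i) + D i ≅ coeff g i
    step i = begin
      (s * D (suc i) + D i) % p                         ≡⟨ cong (λ z → (s * D (suc i) + z) % p) (eval-drop r g i) ⟩
      (s * D (suc i) + (coeff g i + r * D (suc i))) % p ≡⟨ cong (_% p) (collect s r (coeff g i) (D (suc i))) ⟩
      (coeff g i + D (suc i) * (s + r)) % p             ≡⟨ cong (λ z → (coeff g i + D (suc i) * z) % p) s+r≡p ⟩
      (coeff g i + D (suc i) * p) % p                   ≡⟨ +-*-modulus (coeff g i) (D (suc i)) ⟩
      coeff g i % p                                     ∎
      where open ≡-Reasoning
    coeff-≅ : ∀ i → coeff ((X+ s) ⊛ quotientBy r g) i + coeff (eval r g ∷ []) i ≅ coeff g i
    coeff-≅ zero = begin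
      (coeff ((X+ s) ⊛ quotientBy r g) 0 + eval r g) % p
        ≡⟨ cong (λ z → (z + eval r g) % p) (coeff-X+-⊛ s (quotientBy r g) 0) ⟩
      (s * coeff (quotientBy r g) 0 + 0 + D 0) % p
        ≡⟨ cong (λ z → (z + D 0) % p) (+-identityʳ _) ⟩
      (s * coeff (quotientBy r g) 0 + D 0) % p
        ≡⟨ cong (λ z → (s * z + D 0) % p) (coeff-quotientBy r g 0) ⟩
      (s * D 1 + D 0) % p
        ≡⟨ step 0 ⟩
      coeff g 0 % p ∎
      where open ≡-Reasoning
    coeff-≅ (suc j) = begin
      (coeff ((X+ s) ⊛ quotientBy r g) (suc j) + 0) % p
        ≡⟨ cong (_% p) (trans (+-identityʳ _) (coeff-X+-⊛ s (quotientBy r g) (suc j))) ⟩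
      (s * coeff (quotientBy r g) (suc j) + coeff (quotientBy r g) j) % p
        ≡⟨ cong₂ (λ z w → (s * z + w) % p) (coeff-quotientBy r g (suc j)) (coeff-quotientBy r g j) ⟩
      (s * D (suc (suc j)) + D (suc j)) % p
        ≡⟨ step (suc j) ⟩
      coeff g (suc j) % p ∎
      where open ≡-Reasoning

  -- Each root r splits off X - r, and the quotient keeps the smaller roots since p ∤ r - r'.
  roots⇒≈[] : ∀ n → n ≤ p → ∀ g → (∀ i → n ≤ i → coeff g i ≅ 0) → (∀ r → r < n → eval r g ≅ 0) →
              g ≈ []
  roots⇒≈[] zero    _   g high≅0 root = mk≈ (λ i → high≅0 i z≤n)
  roots⇒≈[] (suc n) n<p g high≅0 root =
    ≈-trans (division n s s+n≡p g)
            (≈-trans (⊕-cong≈ (⊛-congʳ≈ (X+ s) q≈[]) (∷-≈ (root n ≤-refl) ≈-refl)) (≋⇒≈ (⊛-zeroʳ (X+ s))))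
    where
    s : ℕ
    s = p ∸ n
    s+n≡p : s + n ≡ p
    s+n≡p = m∸n+n≡m (<⇒≤ n<p)
    q : Poly
    q = quotientBy n g
    q-high≅0 : ∀ i → n ≤ i → coeff q i ≅ 0
    q-high≅0 i n≤i = trans (cong (_% p) (coeff-quotientBy n g i))
      (eval-≈[] n (drop (suc i) g) (mk≈ λ j → trans (cong (_% p) (coeff-drop (suc i) g j))
                                                   (high≅0 (suc i + j) (s≤s (≤-trans n≤i (m≤m+n i j))))))
    q-root : ∀ r → r < n → eval r q ≅ 0
    q-root r r<n = *≅0⇒≅0 (s + r) (eval r q) (trans (sym g[r]≅) (root r (m<n⇒m<1+n r<n))) p∤s+r
      where
      g[r]≅ : eval r g ≅ (s + r) * eval r q
      g[r]≅ = begin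
        eval r g % p
          ≡⟨ eval-≈ r (division n s s+n≡p g) ⟩
        eval r (((X+ s) ⊛ q) ⊕ (eval n g ∷ [])) % p
          ≡⟨ cong (_% p) (eval-⊕ r ((X+ s) ⊛ q) (eval n g ∷ [])) ⟩
        (eval r ((X+ s) ⊛ q) + (eval n g + r * 0)) % p
          ≡⟨ +-≅ˡ (eval r ((X+ s) ⊛ q)) (+-≅ (root n ≤-refl) (cong (_% p) (*-zeroʳ r))) ⟩
        (eval r ((X+ s) ⊛ q) + 0) % p
          ≡⟨ cong (_% p) (trans (+-identityʳ _) (trans (eval-⊛ r (X+ s) q) (cong (_* eval r q) (eval-X+ r s)))) ⟩
        ((s + r) * eval r q) % p ∎
        where open ≡-Reasoning
      p∤s+r : ¬ (p ∣ (s + r))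
      p∤s+r = p∤0<n<p (≤-trans (m<n⇒0<n∸m n<p) (m≤m+n s r)) (subst (s + r <_) s+n≡p (+-monoʳ-< s r<n))
    q≈[] : q ≈ []
    q≈[] = roots⇒≈[] n (<⇒≤ n<p) q q-high≅0 q-root

  values⇒≈ : ∀ n → n ≤ p → ∀ g h → (∀ i → n ≤ i → coeff g i ≅ coeff h i) →
             (∀ r → r < n → eval r g ≅ eval r h) → g ≈ h
  values⇒≈ n n≤p g h high≅ values≅ = mk≈ λ i →
    +[m∸1]*≅0⇒≅ (trans (cong (_% p) (sym (coeff-g-h i))) (g-h≈[] .at≈ i))
    where
    g-h : Poly
    g-h = g ⊕ map ((p ∸ 1) *_) h
    coeff-g-h : ∀ i → coeff g-h i ≡ coeff g i + (p ∸ 1) * coeff h i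
    coeff-g-h i = trans (coeff-⊕ g _ i) (cong (coeff g i +_) (coeff-map (p ∸ 1) h i))
    eval-g-h : ∀ r → eval r g-h ≡ eval r g + (p ∸ 1) * eval r h
    eval-g-h r = trans (eval-⊕ r g _) (cong (eval r g +_) (eval-map r (p ∸ 1) h))
    g-h≈[] : g-h ≈ []
    g-h≈[] = roots⇒≈[] n n≤p g-h
      (λ i n≤i → trans (cong (_% p) (coeff-g-h i)) (≅⇒+[m∸1]*≅0 (high≅ i n≤i)))
      (λ r r<n → trans (cong (_% p) (eval-g-h r)) (≅⇒+[m∸1]*≅0 (values≅ r r<n)))

  Monic : ℕ → Poly → Set
  Monic n g = (coeff g n ≡ 1) × (∀ i → n < i → coeff g i ≡ 0)

  one-monic : Monic 0 one
  one-monic = refl , λ { (suc i) _ → refl }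

  X+-⊛-monic : ∀ s n q → Monic n q → Monic (suc n) ((X+ s) ⊛ q)
  X+-⊛-monic s n q (qₙ≡1 , q-high≡0) = leading , high
    where
    leading : coeff ((X+ s) ⊛ q) (suc n) ≡ 1
    leading = trans (coeff-X+-⊛ s q (suc n))
                    (trans (cong₂ (λ x y → s * x + y) (q-high≡0 (suc n) ≤-refl) qₙ≡1) (cong (_+ 1) (*-zeroʳ s)))
    high : ∀ i → suc n < i → coeff ((X+ s) ⊛ q) i ≡ 0
    high (suc i) (s≤s n<i) = trans (coeff-X+-⊛ s q (suc i))
      (trans (cong₂ (λ x y → s * x + y) (q-high≡0 (suc i) (m<n⇒m<1+n n<i)) (q-high≡0 i n<i)) (cong (_+ 0) (*-zeroʳ s)))

  pow-X+-monic : ∀ s n → Monic n (pow (X+ s) n)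
  pow-X+-monic s zero    = one-monic
  pow-X+-monic s (suc n) = X+-⊛-monic s n (pow (X+ s) n) (pow-X+-monic s n)

  binomial-monic : ∀ c k n → k < n → Monic n (mono c k ⊕ mono 1 n)
  binomial-monic c k n k<n = leading , high
    where
    leading : coeff (mono c k ⊕ mono 1 n) n ≡ 1
    leading = trans (coeff-⊕ (mono c k) (mono 1 n) n)
                    (cong₂ _+_ (coeff-mono-≢ c k n (≢-sym (<⇒≢ k<n))) (coeff-mono-≡ 1 n))
    high : ∀ i → n < i → coeff (mono c k ⊕ mono 1 n) i ≡ 0
    high i n<i = trans (coeff-⊕ (mono c k) (mono 1 n) i)
      (cong₂ _+_ (coeff-mono-≢ c k i (≢-sym (<⇒≢ (<-trans k<n n<i)))) (coeff-mono-≢ 1 n i (≢-sym (<⇒≢ n<i))))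

  monic-values⇒≈ : ∀ {g h} → Monic p g → Monic p h → (∀ r → r < p → eval r g ≅ eval r h) → g ≈ h
  monic-values⇒≈ {g} {h} (gₚ≡1 , g-high≡0) (hₚ≡1 , h-high≡0) = values⇒≈ p ≤-refl g h high≅
    where
    high≅ : ∀ i → p ≤ i → coeff g i ≅ coeff h i
    high≅ i p≤i with m≤n⇒m<n∨m≡n p≤i
    ... | inj₁ p<i  = cong (_% p) (trans (g-high≡0 i p<i) (sym (h-high≡0 i p<i)))
    ... | inj₂ refl = cong (_% p) (trans gₚ≡1 (sym hₚ≡1))

  coeff-pow-X+1 : ∀ n i → coeff (pow (X+ 1) n) i ≡ n C i
  coeff-pow-X+1 zero    zero    = refl
  coeff-pow-X+1 zero    (suc i) = refl
  coeff-pow-X+1 (suc n) i       = trans (coeff-X+-⊛ 1 (pow (X+ 1) n) i) (pascal i)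
    where
    pascal : ∀ i → 1 * coeff (pow (X+ 1) n) i + coeff (0 ∷ pow (X+ 1) n) i ≡ suc n C i
    pascal zero    = trans (+-identityʳ _) (trans (*-identityˡ _) (coeff-pow-X+1 n 0))
    pascal (suc i) = trans (cong₂ _+_ (trans (*-identityˡ _) (coeff-pow-X+1 n (suc i))) (coeff-pow-X+1 n i))
                           (trans (+-comm (n C suc i) (n C i)) (nCk+nC[k+1]≡[n+1]C[k+1] n i))

  p∤! : ∀ j → j < p → ¬ (p ∣ j !)
  p∤! zero    _    p∣1 = p∤1 p∣1
  p∤! (suc j) j<p p∣j! with euclidsLemma (suc j) (j !) p-prime p∣j!
  ... | inj₁ p∣1+j = p∤0<n<p z<s j<p p∣1+j
  ... | inj₂ p∣j!  = p∤! j (<-trans (n<1+n j) j<p) p∣j!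

  p∣pCi : ∀ i → 0 < i → i < p → p ∣ p C i
  p∣pCi i 0<i i<p with euclidsLemma (p C i) _ p-prime p∣pCi*i!*[p∸i]!
    where
    instance
      _ : NonZero (i ! * (p ∸ i) !)
      _ = i !* (p ∸ i) !≢0
    p∣p! : p ∣ p !
    p∣p! = subst (λ n → n ∣ n !) (suc-pred p) (m∣m*n ((p ∸ 1) !))
    p∣pCi*i!*[p∸i]! : p ∣ (p C i) * (i ! * (p ∸ i) !)
    p∣pCi*i!*[p∸i]! = subst (p ∣_) (sym (trans (cong (_* (i ! * (p ∸ i) !)) (nCk≡n!/k![n-k]! (<⇒≤ i<p)))
                                                (m/n*n≡m (k![n∸k]!∣n! (<⇒≤ i<p))))) p∣p!
  ... | inj₁ p∣pCi = p∣pCi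
  ... | inj₂ p∣i!*[p∸i]! with euclidsLemma (i !) ((p ∸ i) !) p-prime p∣i!*[p∸i]!
  ...   | inj₁ p∣i!     = ⊥-elim (p∤! i i<p p∣i!)
  ...   | inj₂ p∣[p∸i]! = ⊥-elim (p∤! (p ∸ i) (∸-monoʳ-< 0<i (<⇒≤ i<p)) p∣[p∸i]!)

  freshman's-dream : pow (X+ 1) p ≈ (mono 1 0 ⊕ mono 1 p)
  freshman's-dream .at≈ i =
    trans (cong (_% p) (coeff-pow-X+1 p i)) (sym (trans (cong (_% p) (coeff-⊕ (mono 1 0) (mono 1 p) i)) (binomial i)))
    where
    binomial : ∀ i → coeff (mono 1 0) i + coeff (mono 1 p) i ≅ p C i
    binomial zero = cong (λ z → (1 + z) % p) (coeff-mono-≢ 1 p 0 (<⇒≢ (<-trans z<s 1<p)))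
    binomial (suc i) with <-cmp (suc i) p
    ... | tri< i<p _ _ = trans (cong (_% p) (coeff-mono-≢ 1 p (suc i) (<⇒≢ i<p))) (sym (∣⇒≅0 (p∣pCi (suc i) z<s i<p)))
    ... | tri≈ _ refl _ = cong (_% p) (trans (coeff-mono-≡ 1 (suc i)) (sym (nCn≡1 (suc i))))
    ... | tri> _ _ p<i = cong (_% p) (trans (coeff-mono-≢ 1 p (suc i) (≢-sym (<⇒≢ p<i))) (sym (k>n⇒nCk≡0 p<i)))

  fermat : ∀ a → a ^ p ≅ a
  fermat zero    = cong (λ n → (0 ^ n) % p) (sym (suc-pred p))
  fermat (suc a) = begin
    (suc a ^ p) % p                          ≡⟨ cong (λ z → (z ^ p) % p) (eval-X+ a 1) ⟨
    (eval a (X+ 1) ^ p) % p                  ≡⟨ cong (_% p) (eval-pow a (X+ 1) p) ⟨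
    eval a (pow (X+ 1) p) % p                ≡⟨ eval-≈ a freshman's-dream ⟩
    eval a (mono 1 0 ⊕ mono 1 p) % p         ≡⟨ cong (_% p) (trans (eval-⊕ a (mono 1 0) (mono 1 p))
                                                                (cong₂ _+_ (eval-mono a 1 0) (eval-mono a 1 p))) ⟩
    (1 * a ^ 0 + 1 * a ^ p) % p              ≡⟨ cong (λ z → (1 + z) % p) (*-identityˡ (a ^ p)) ⟩
    (1 + a ^ p) % p                          ≡⟨ +-≅ˡ 1 (fermat a) ⟩
    suc a % p                                ∎
    where open ≡-Reasoning

  fermat-^1+* : ∀ t k → t ^ (1 + k * (p ∸ 1)) ≅ t
  fermat-^1+* t zero    = cong (_% p) (trans (cong (t ^_) (+-identityʳ 1)) (*-identityʳ t))
  fermat-^1+* t (suc k) = begin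
    (t ^ (1 + (P + k * P))) % p       ≡⟨ cong (λ n → (t ^ n) % p) (sym (+-assoc 1 P (k * P))) ⟩
    (t ^ (1 + P + k * P)) % p         ≡⟨ cong (_% p) (^-distribˡ-+-* t (1 + P) (k * P)) ⟩
    (t ^ (1 + P) * t ^ (k * P)) % p   ≡⟨ *-≅ (trans (cong (λ n → (t ^ n) % p) (suc-pred p)) (fermat t)) refl ⟩
    (t ^ (1 + k * P)) % p             ≡⟨ fermat-^1+* t k ⟩
    t % p                             ∎
    where
    open ≡-Reasoning
    P : ℕ
    P = p ∸ 1

  Nth-root : ∀ u N k → u * N ≡ 1 + k * (p ∸ 1) → ∀ t → (t ^ u) ^ N ≅ t
  Nth-root u N k uN≡1+kP t = trans (cong (_% p) (trans (^-*-assoc t u N) (cong (t ^_) uN≡1+kP))) (fermat-^1+* t k)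

  frobenius : ∀ j → pow (X+ j) p ≈ (mono j 0 ⊕ mono 1 p)
  frobenius j = monic-values⇒≈ (pow-X+-monic j p) (binomial-monic j 0 p (<-trans z<s 1<p)) values≅
    where
    values≅ : ∀ r → r < p → eval r (pow (X+ j) p) ≅ eval r (mono j 0 ⊕ mono 1 p)
    values≅ r _ = begin
      eval r (pow (X+ j) p) % p        ≡⟨ cong (_% p) (trans (eval-pow r (X+ j) p) (cong (_^ p) (eval-X+ r j))) ⟩
      ((j + r) ^ p) % p                ≡⟨ fermat (j + r) ⟩
      (j + r) % p                      ≡⟨ +-≅ (cong (_% p) (sym (*-identityʳ j)))
                                              (sym (trans (cong (_% p) (*-identityˡ (r ^ p))) (fermat r))) ⟩
      (j * 1 + 1 * r ^ p) % p          ≡⟨ cong (_% p) (trans (eval-⊕ r (mono j 0) (mono 1 p))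
                                                             (cong₂ _+_ (eval-mono r j 0) (eval-mono r 1 p))) ⟨
      eval r (mono j 0 ⊕ mono 1 p) % p ∎
      where open ≡-Reasoning

  rising : ℕ → Poly
  rising zero    = one
  rising (suc n) = (X+ n) ⊛ rising n

  rising-monic : ∀ n → Monic n (rising n)
  rising-monic zero    = one-monic
  rising-monic (suc n) = X+-⊛-monic n n (rising n) (rising-monic n)

  k+r∣rising : ∀ n k r → k < n → (k + r) ∣ eval r (rising n)
  k+r∣rising (suc n) k r k<1+n
    rewrite eval-⊛ r (X+ n) (rising n) | eval-X+ r n with m≤n⇒m<n∨m≡n (≤-pred k<1+n)
  ... | inj₁ k<n  = ∣n⇒∣m*n (n + r) (k+r∣rising n k r k<n)
  ... | inj₂ refl = m∣m*n (eval r (rising n))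

  rising-root : ∀ r → r < p → eval r (rising p) ≅ 0
  rising-root zero    _   = ∣⇒≅0 (∣-trans (divides 0 refl) (k+r∣rising p 0 0 (<-trans z<s 1<p)))
  rising-root (suc r) r<p =
    ∣⇒≅0 (subst (_∣ eval (suc r) (rising p)) (m∸n+n≡m (<⇒≤ r<p))
                (k+r∣rising p (p ∸ suc r) (suc r) (∸-monoʳ-< z<s (<⇒≤ r<p))))

  Xᵖ-X : Poly
  Xᵖ-X = mono (p ∸ 1) 1 ⊕ mono 1 p

  -- Both sides are monic of degree p and vanish on 𝔽ₚ.
  rising≈Xᵖ-X : rising p ≈ Xᵖ-X
  rising≈Xᵖ-X = monic-values⇒≈ (rising-monic p) (binomial-monic (p ∸ 1) 1 p 1<p) values≅
    where
    values≅ : ∀ r → r < p → eval r (rising p) ≅ eval r Xᵖ-X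
    values≅ r r<p = trans (rising-root r r<p) (sym (begin
      eval r Xᵖ-X % p                    ≡⟨ cong (_% p) (trans (eval-⊕ r (mono (p ∸ 1) 1) (mono 1 p))
                                                             (cong₂ _+_ (eval-mono r (p ∸ 1) 1) (eval-mono r 1 p))) ⟩
      ((p ∸ 1) * (r * 1) + 1 * r ^ p) % p ≡⟨ +-≅ (cong (λ z → ((p ∸ 1) * z) % p) (*-identityʳ r))
                                                 (trans (cong (_% p) (*-identityˡ (r ^ p))) (fermat r)) ⟩
      ((p ∸ 1) * r + r) % p               ≡⟨ cong (_% p) (+-comm ((p ∸ 1) * r) r) ⟩
      (r + (p ∸ 1) * r) % p               ≡⟨ ≅⇒+[m∸1]*≅0 refl ⟩
      0 % p                               ∎))
      where open ≡-Reasoning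

-- g ~ h means g ≡ h modulo the polynomial M over 𝔽ₚ, witnessed without subtraction.
module ModuloPolynomial (p : ℕ) ⦃ _ : NonZero p ⦄ (M : Poly) where

  open CoefficientLists
  open Residues p

  infix 4 _~_
  record _~_ (g h : Poly) : Set where
    constructor mk~
    field
      q₁ q₂ : Poly
      eq    : (g ⊕ (M ⊛ q₁)) ≈ (h ⊕ (M ⊛ q₂))

  ≈⇒~ : ∀ {g h} → g ≈ h → g ~ h
  ≈⇒~ g≈h = mk~ [] [] (⊕-cong≈ g≈h ≈-refl)

  ≋⇒~ : ∀ {g h} → g ≋ h → g ~ h
  ≋⇒~ g≋h = ≈⇒~ (≋⇒≈ g≋h)

  ~-refl : ∀ {g} → g ~ g
  ~-refl = ≈⇒~ ≈-refl

  ~-sym : ∀ {g h} → g ~ h → h ~ g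
  ~-sym (mk~ q₁ q₂ eq) = mk~ q₂ q₁ (≈-sym eq)

  ~-trans : ∀ {g h k} → g ~ h → h ~ k → g ~ k
  ~-trans {g} {h} {k} (mk~ q₁ q₂ g≈h) (mk~ q₃ q₄ h≈k) = mk~ (q₁ ⊕ q₃) (q₄ ⊕ q₂) (begin
    g ⊕ (M ⊛ (q₁ ⊕ q₃))          ≈⟨ ≋⇒≈ (split g q₁ q₃) ⟩
    (g ⊕ (M ⊛ q₁)) ⊕ (M ⊛ q₃)    ≈⟨ ⊕-cong≈ g≈h ≈-refl ⟩
    (h ⊕ (M ⊛ q₂)) ⊕ (M ⊛ q₃)    ≈⟨ ≋⇒≈ (swap h (M ⊛ q₂) (M ⊛ q₃)) ⟩
    (h ⊕ (M ⊛ q₃)) ⊕ (M ⊛ q₂)    ≈⟨ ⊕-cong≈ h≈k ≈-refl ⟩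
    (k ⊕ (M ⊛ q₄)) ⊕ (M ⊛ q₂)    ≈⟨ ≋⇒≈ (≋-sym (split k q₄ q₂)) ⟩
    k ⊕ (M ⊛ (q₄ ⊕ q₂))          ∎)
    where
    open SetoidReasoning ≈-setoid
    split : ∀ a x y → (a ⊕ (M ⊛ (x ⊕ y))) ≋ ((a ⊕ (M ⊛ x)) ⊕ (M ⊛ y))
    split a x y = ≋-trans (⊕-congˡ a (⊛-distribˡ M x y)) (≋-sym (⊕-assoc a (M ⊛ x) (M ⊛ y)))
    swap : ∀ a u v → ((a ⊕ u) ⊕ v) ≋ ((a ⊕ v) ⊕ u)
    swap a u v = ≋-trans (⊕-assoc a u v) (≋-trans (⊕-congˡ a (⊕-comm u v)) (≋-sym (⊕-assoc a v u)))

  ~-⊛ʳ : ∀ {g h} k → g ~ h → (g ⊛ k) ~ (h ⊛ k)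
  ~-⊛ʳ {g} {h} k (mk~ q₁ q₂ g≈h) =
    mk~ (q₁ ⊛ k) (q₂ ⊛ k)
        (≈-trans (≋⇒≈ (factor g q₁)) (≈-trans (⊛-congˡ≈ k g≈h) (≋⇒≈ (≋-sym (factor h q₂)))))
    where
    factor : ∀ a q → ((a ⊛ k) ⊕ (M ⊛ (q ⊛ k))) ≋ ((a ⊕ (M ⊛ q)) ⊛ k)
    factor a q = ≋-trans (⊕-congˡ (a ⊛ k) (≋-sym (⊛-assoc M q k))) (≋-sym (⊛-distribʳ a (M ⊛ q) k))

  ~-⊛ : ∀ {g g' h h'} → g ~ g' → h ~ h' → (g ⊛ h) ~ (g' ⊛ h')
  ~-⊛ {g} {g'} {h} {h'} g~g' h~h' =
    ~-trans (~-⊛ʳ h g~g') (~-trans (≋⇒~ (⊛-comm g' h)) (~-trans (~-⊛ʳ g' h~h') (≋⇒~ (⊛-comm h' g'))))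

  ~-⊕ˡ : ∀ {g h} k → g ~ h → (k ⊕ g) ~ (k ⊕ h)
  ~-⊕ˡ {g} {h} k (mk~ q₁ q₂ g≈h) =
    mk~ q₁ q₂ (≈-trans (≋⇒≈ (⊕-assoc k g (M ⊛ q₁)))
              (≈-trans (⊕-cong≈ (≈-refl {k}) g≈h) (≋⇒≈ (≋-sym (⊕-assoc k h (M ⊛ q₂))))))

  pow-~ : ∀ {g h} n → g ~ h → pow g n ~ pow h n
  pow-~ zero    g~h = ~-refl
  pow-~ (suc n) g~h = ~-⊛ g~h (pow-~ n g~h)

  divides⇒~ : ∀ r → Divides p M (XpowMinus1 p r) → pow X r ~ one
  divides⇒~ r (h , Xʳ-1≈Mh) = mk~ [] h (begin
    pow X r ⊕ (M ⊛ [])                   ≈⟨ ≋⇒≈ (≋-trans (⊕-congˡ (pow X r) (⊛-zeroʳ M)) (⊕-identityʳ _)) ⟩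
    pow X r                              ≈⟨ ≋⇒≈ (≋-sym (mono1≋powX r)) ⟩
    mono 1 r                             ≈⟨ mk≈ (λ i → sym (trans (cong (_% p) (coeff-one⊕Xʳ-1 i)) (coeff-≅ i))) ⟩
    one ⊕ XpowMinus1 p r                 ≈⟨ ⊕-cong≈ (≈-refl {one}) (≈[]⇒≈ {XpowMinus1 p r} {M ⊛ h} Xʳ-1≈Mh) ⟩
    one ⊕ (M ⊛ h)                        ∎)
    where
    open SetoidReasoning ≈-setoid
    coeff-one⊕Xʳ-1 : ∀ i → coeff (one ⊕ XpowMinus1 p r) i ≡ coeff one i + (coeff (mono (p ∸ 1) 0) i + coeff (mono 1 r) i)
    coeff-one⊕Xʳ-1 i = trans (coeff-⊕ one (XpowMinus1 p r) i) (cong (coeff one i +_) (coeff-⊕ (mono (p ∸ 1) 0) (mono 1 r) i))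
    coeff-≅ : ∀ i → coeff one i + (coeff (mono (p ∸ 1) 0) i + coeff (mono 1 r) i) ≅ coeff (mono 1 r) i
    coeff-≅ zero    = 1+[[m∸1]+x]≅x (coeff (mono 1 r) 0)
    coeff-≅ (suc i) = refl

  ~⇒divides : ∀ r → pow X r ~ one → Divides p M (XpowMinus1 p r)
  ~⇒divides r (mk~ q₁ q₂ Xʳ+Mq₁≈1+Mq₂) = h , ≈⇒≈[] {XpowMinus1 p r} {M ⊛ h} (mk≈ λ i →
    trans (cong (_% p) (coeff-Xʳ-1 i))
          (trans (exchange-≅ (coeff (pow X r) i) (coeff (M ⊛ q₁) i) (coeff (M ⊛ q₂) i) (coeff one i) (coeff-≅ i))
                 (cong (_% p) (sym (coeff-Mh i)))))
    where
    h : Poly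
    h = q₂ ⊕ map ((p ∸ 1) *_) q₁
    coeff-≅ : ∀ i → coeff (pow X r) i + coeff (M ⊛ q₁) i ≅ coeff one i + coeff (M ⊛ q₂) i
    coeff-≅ i = trans (cong (_% p) (sym (coeff-⊕ (pow X r) (M ⊛ q₁) i)))
                      (trans (Xʳ+Mq₁≈1+Mq₂ .at≈ i) (cong (_% p) (coeff-⊕ one (M ⊛ q₂) i)))
    coeff-Xʳ-1 : ∀ i → coeff (XpowMinus1 p r) i ≡ (p ∸ 1) * coeff one i + coeff (pow X r) i
    coeff-Xʳ-1 i = trans (coeff-⊕ (mono (p ∸ 1) 0) (mono 1 r) i) (cong₂ _+_ (constant i) (mono1≋powX r .at i))
      where
      constant : ∀ i → coeff (mono (p ∸ 1) 0) i ≡ (p ∸ 1) * coeff one i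
      constant zero    = sym (*-identityʳ _)
      constant (suc i) = sym (*-zeroʳ (p ∸ 1))
    coeff-Mh : ∀ i → coeff (M ⊛ h) i ≡ coeff (M ⊛ q₂) i + (p ∸ 1) * coeff (M ⊛ q₁) i
    coeff-Mh i = trans (⊛-distribˡ M q₂ (map ((p ∸ 1) *_) q₁) .at i)
      (trans (coeff-⊕ (M ⊛ q₂) _ i)
             (cong (coeff (M ⊛ q₂) i +_) (trans (⊛-mapʳ (p ∸ 1) M q₁ .at i) (coeff-map (p ∸ 1) (M ⊛ q₁) i))))

module ArtinSchreier (p : ℕ) (p-prime : Prime p) where

  open CoefficientLists
  open PrimeField p p-prime

  F : Poly
  F = fSub p (p ∸ 1) 1

  open ModuloPolynomial p F

  coeff-F : ∀ i → coeff F i ≡ coeff (mono (p ∸ 1) 0) i + (coeff (mono (p ∸ 1) 1) i + coeff (mono 1 p) i)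
  coeff-F i = trans (coeff-⊕ (mono (p ∸ 1) 0) (mono (p ∸ 1) 1 ⊕ mono 1 (p * 1)) i)
    (cong (coeff (mono (p ∸ 1) 0) i +_) (trans (coeff-⊕ (mono (p ∸ 1) 1) (mono 1 (p * 1)) i)
      (cong (λ n → coeff (mono (p ∸ 1) 1) i + coeff (mono 1 n) i) (*-identityʳ p))))

  coeff₀-Xᵖ : coeff (mono 1 p) 0 ≡ 0
  coeff₀-Xᵖ = coeff-mono-≢ 1 p 0 (<⇒≢ (<-trans z<s 1<p))

  coeff₁-Xᵖ : coeff (mono 1 p) 1 ≡ 0
  coeff₁-Xᵖ = coeff-mono-≢ 1 p 1 (<⇒≢ 1<p)

  ≈+F⇒~ : ∀ {g h} → g ≈ (h ⊕ F) → g ~ h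
  ≈+F⇒~ {g} {h} g≈h+F = mk~ [] one (≈-trans (≋⇒≈ (≋-trans (⊕-congˡ g (⊛-zeroʳ F)) (⊕-identityʳ g)))
                                            (≈-trans g≈h+F (≋⇒≈ (⊕-congˡ h (≋-sym (⊛-identityʳ F))))))

  Xᵖ~X+1 : mono 1 p ~ X+ 1
  Xᵖ~X+1 = ≈+F⇒~ (mk≈ λ i → sym (trans (cong (_% p) (trans (coeff-⊕ (X+ 1) F i) (cong (coeff (X+ 1) i +_) (coeff-F i))))
                                         (coeff-≅ i)))
    where
    coeff-≅ : ∀ i → coeff (X+ 1) i + (coeff (mono (p ∸ 1) 0) i + (coeff (mono (p ∸ 1) 1) i + coeff (mono 1 p) i))
                    ≅ coeff (mono 1 p) i
    coeff-≅ zero = trans (cong (λ z → (1 + ((p ∸ 1) + (0 + z))) % p) coeff₀-Xᵖ)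
                         (trans (1+[[m∸1]+x]≅x 0) (cong (_% p) (sym coeff₀-Xᵖ)))
    coeff-≅ (suc zero) = trans (cong (λ z → (1 + (0 + ((p ∸ 1) + z))) % p) coeff₁-Xᵖ)
                               (trans (1+[[m∸1]+x]≅x 0) (cong (_% p) (sym coeff₁-Xᵖ)))
    coeff-≅ (suc (suc j)) = refl

  Xᵖ-X~1 : Xᵖ-X ~ one
  Xᵖ-X~1 = ≈+F⇒~ (mk≈ λ i → sym (trans (cong (_% p) (trans (coeff-⊕ one F i) (cong (coeff one i +_) (coeff-F i))))
                                        (trans (coeff-≅ i) (cong (_% p) (sym (coeff-⊕ (mono (p ∸ 1) 1) (mono 1 p) i))))))
    where
    coeff-≅ : ∀ i → coeff one i + (coeff (mono (p ∸ 1) 0) i + (coeff (mono (p ∸ 1) 1) i + coeff (mono 1 p) i))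
                    ≅ coeff (mono (p ∸ 1) 1) i + coeff (mono 1 p) i
    coeff-≅ zero          = 1+[[m∸1]+x]≅x (0 + coeff (mono 1 p) 0)
    coeff-≅ (suc zero)    = refl
    coeff-≅ (suc (suc j)) = refl

  powX[pᵏ]~X+k : ∀ k → pow X (p ^ k) ~ X+ k
  powX[pᵏ]~X+k zero    = ≋⇒~ (⊛-identityʳ X)
  powX[pᵏ]~X+k (suc k) =
    ~-trans (≋⇒~ (pow-* X p (p ^ k)))
    (~-trans (pow-~ p (powX[pᵏ]~X+k k))
    (~-trans (≈⇒~ (frobenius k))
    (~-trans (~-⊕ˡ (mono k 0) Xᵖ~X+1)
             (≋⇒~ (∷-≋ (+-comm k 1) ≋-refl)))))

  repunit : ℕ → ℕ
  repunit zero    = 0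
  repunit (suc n) = p ^ n + repunit n

  powX[repunit]~rising : ∀ n → pow X (repunit n) ~ rising n
  powX[repunit]~rising zero    = ~-refl
  powX[repunit]~rising (suc n) =
    ~-trans (≋⇒~ (pow-+ X (p ^ n) (repunit n))) (~-⊛ (powX[pᵏ]~X+k n) (powX[repunit]~rising n))

  -- The norm of X from 𝔽ₚ[X]/(F) is 1.
  powX[repunit-p]~1 : pow X (repunit p) ~ one
  powX[repunit-p]~1 = ~-trans (powX[repunit]~rising p) (~-trans (≈⇒~ rising≈Xᵖ-X) Xᵖ-X~1)

  order∣repunit : ∀ {e} → IsOrder p F e → e ∣ repunit p
  order∣repunit {e} (0<e , F∣Xᵉ-1 , minimal) = e∣E
    where
    E : ℕ
    E = repunit p
    instance
      e≢0 : NonZero e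
      e≢0 = >-nonZero 0<e
    powX[ke]~1 : ∀ k → pow X (k * e) ~ one
    powX[ke]~1 k = ~-trans (≋⇒~ (pow-* X k e)) (~-trans (pow-~ k (divides⇒~ e F∣Xᵉ-1)) (≋⇒~ (pow-one k)))
    pow-≡ : ∀ {m n} → m ≡ n → pow X m ≋ pow X n
    pow-≡ refl = ≋-refl
    powX[E%e]~1 : pow X (E % e) ~ one
    powX[E%e]~1 =
      ~-trans (≋⇒~ (≋-sym (⊛-identityʳ (pow X (E % e)))))
      (~-trans (~-⊛ (~-refl {pow X (E % e)}) (~-sym (powX[ke]~1 (E / e))))
      (~-trans (≋⇒~ (≋-sym (pow-+ X (E % e) (E / e * e))))
      (~-trans (≋⇒~ (pow-≡ (sym (m≡m%n+[m/n]*n E e)))) powX[repunit-p]~1)))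
    e∣E : e ∣ E
    e∣E with E % e in E%e≡
    ... | zero  = m%n≡0⇒n∣m E e E%e≡
    ... | suc r = ⊥-elim (<⇒≱ (subst (_< e) E%e≡ (m%n<n E e))
                              (minimal (suc r) z<s (~⇒divides (suc r) (subst (λ n → pow X n ~ one) E%e≡ powX[E%e]~1))))

  repunit≅ : ∀ {m} ⦃ _ : NonZero m ⦄ → m ∣ p ∸ 1 → ∀ n → ModularArithmetic._≅_ m (repunit n) n
  repunit≅ {m} m∣p∸1 zero    = refl
  repunit≅ {m} m∣p∸1 (suc n) =
    Mod.+-≅ {p ^ n} {1} (trans (Mod.^-≅ n (Mod.∣∸⇒≅ (<⇒≤ 1<p) m∣p∸1)) (cong (_% m) (^-zeroˡ n)))
                        (repunit≅ m∣p∸1 n)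
    where module Mod = ModularArithmetic m

  -- ℓ divides the repunit, which is ≡ p ≡ 1 modulo any divisor of p - 1.
  prime∣order⇒∤p∸1 : ∀ {e ℓ} → IsOrder p F e → Prime ℓ → ℓ ∣ e → ¬ (ℓ ∣ p ∸ 1)
  prime∣order⇒∤p∸1 {e} {ℓ} order ℓ-prime ℓ∣e ℓ∣p∸1 =
    nonTrivial⇒≢1 ⦃ prime⇒nonTrivial ℓ-prime ⦄ (∣1⇒≡1 (Mod.≅0⇒∣ (trans (sym E≅1) E≅0)))
    where
    instance
      ℓ≢0 : NonZero ℓ
      ℓ≢0 = prime⇒nonZero ℓ-prime
    module Mod = ModularArithmetic ℓ
    E≅1 : Mod._≅_ (repunit p) 1
    E≅1 = trans (repunit≅ ℓ∣p∸1 p) (Mod.∣∸⇒≅ (<⇒≤ 1<p) ℓ∣p∸1)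
    E≅0 : Mod._≅_ (repunit p) 0
    E≅0 = Mod.∣⇒≅0 (∣-trans ℓ∣e (order∣repunit order))

module Twisting (p : ℕ) (p-prime : Prime p) where

  open CoefficientLists
  open PrimeField p p-prime

  -- scale d f = f(dX)
  scale : ℕ → Poly → Poly
  scale d []      = []
  scale d (c ∷ f) = c ∷ map (d *_) (scale d f)

  coeff-scale : ∀ d f i → coeff (scale d f) i ≡ d ^ i * coeff f i
  coeff-scale d []      i       = sym (*-zeroʳ (d ^ i))
  coeff-scale d (c ∷ f) zero    = sym (+-identityʳ c)
  coeff-scale d (c ∷ f) (suc i) =
    trans (coeff-map d (scale d f) i) (trans (cong (d *_) (coeff-scale d f i)) (sym (*-assoc d (d ^ i) _)))

  scale-⊕ : ∀ d f g → scale d (f ⊕ g) ≋ (scale d f ⊕ scale d g)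
  scale-⊕ d f g .at i = begin
    coeff (scale d (f ⊕ g)) i                    ≡⟨ coeff-scale d (f ⊕ g) i ⟩
    d ^ i * coeff (f ⊕ g) i                      ≡⟨ cong (d ^ i *_) (coeff-⊕ f g i) ⟩
    d ^ i * (coeff f i + coeff g i)              ≡⟨ *-distribˡ-+ (d ^ i) _ _ ⟩
    d ^ i * coeff f i + d ^ i * coeff g i        ≡⟨ cong₂ _+_ (coeff-scale d f i) (coeff-scale d g i) ⟨
    coeff (scale d f) i + coeff (scale d g) i    ≡⟨ coeff-⊕ (scale d f) (scale d g) i ⟨
    coeff (scale d f ⊕ scale d g) i              ∎
    where open ≡-Reasoning

  scale-map : ∀ d a f → scale d (map (a *_) f) ≋ map (a *_) (scale d f)
  scale-map d a f .at i = begin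
    coeff (scale d (map (a *_) f)) i   ≡⟨ coeff-scale d (map (a *_) f) i ⟩
    d ^ i * coeff (map (a *_) f) i     ≡⟨ cong (d ^ i *_) (coeff-map a f i) ⟩
    d ^ i * (a * coeff f i)            ≡⟨ x*[a*y]≡a*[x*y] (d ^ i) a _ ⟩
    a * (d ^ i * coeff f i)            ≡⟨ cong (a *_) (coeff-scale d f i) ⟨
    a * coeff (scale d f) i            ≡⟨ coeff-map a (scale d f) i ⟨
    coeff (map (a *_) (scale d f)) i   ∎
    where
    open ≡-Reasoning
    x*[a*y]≡a*[x*y] : ∀ x a y → x * (a * y) ≡ a * (x * y)
    x*[a*y]≡a*[x*y] = solve-∀

  scale-⊛ : ∀ d f g → scale d (f ⊛ g) ≋ (scale d f ⊛ scale d g)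
  scale-⊛ d []      g = ≋-refl
  scale-⊛ d (a ∷ f) g =
    ≋-trans (scale-⊕ d (map (a *_) g) (0 ∷ (f ⊛ g)))
            (⊕-cong (scale-map d a g)
                    (∷-≋ refl (≋-trans (map-cong d (scale-⊛ d f g)) (≋-sym (⊛-mapˡ d (scale d f) (scale d g))))))

  scale-cong≈ : ∀ d {f g} → f ≈ g → scale d f ≈ scale d g
  scale-cong≈ d {f} {g} f≈g .at≈ i =
    trans (cong (_% p) (coeff-scale d f i)) (trans (*-≅ˡ (d ^ i) (f≈g .at≈ i)) (cong (_% p) (sym (coeff-scale d g i))))

  twist : ℕ → ℕ → Poly → Poly
  twist c d f = map (c *_) (scale d f)

  coeff-twist : ∀ c d f i → coeff (twist c d f) i ≡ c * (d ^ i * coeff f i)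
  coeff-twist c d f i = trans (coeff-map c (scale d f) i) (cong (c *_) (coeff-scale d f i))

  twist-⊛ : ∀ c d f g → twist c d (f ⊛ g) ≋ (twist c d f ⊛ twist 1 d g)
  twist-⊛ c d f g =
    ≋-trans (map-cong c (≋-trans (scale-⊛ d f g) (⊛-congʳ (scale d f) (≋-sym (map-1 (scale d g))))))
            (≋-sym (⊛-mapˡ c (scale d f) (twist 1 d g)))

  twist-⊕ : ∀ c d f g → twist c d (f ⊕ g) ≋ (twist c d f ⊕ twist c d g)
  twist-⊕ c d f g = ≋-trans (map-cong c (scale-⊕ d f g)) (map-⊕ c (scale d f) (scale d g))

  twist-cong≈ : ∀ c d {f g} → f ≈ g → twist c d f ≈ twist c d g
  twist-cong≈ c d f≈g = map-cong≈ c (scale-cong≈ d f≈g)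

  twist-mono : ∀ c d x k y → c * (d ^ k * x) ≅ y → twist c d (mono x k) ≈ mono y k
  twist-mono c d x k y c*dᵏ*x≅y .at≈ i = trans (cong (_% p) (coeff-twist c d (mono x k) i)) (coeff-≅ (i ≟ k))
    where
    coeff-≅ : Dec (i ≡ k) → c * (d ^ i * coeff (mono x k) i) ≅ coeff (mono y k) i
    coeff-≅ (yes refl) = trans (cong (λ z → (c * (d ^ i * z)) % p) (coeff-mono-≡ x i))
                               (trans c*dᵏ*x≅y (cong (_% p) (sym (coeff-mono-≡ y i))))
    coeff-≅ (no i≢k)   = cong (_% p) (trans (cong (λ z → c * (d ^ i * z)) (coeff-mono-≢ x k i i≢k))
                                    (trans (cong (c *_) (*-zeroʳ (d ^ i))) (trans (*-zeroʳ c) (sym (coeff-mono-≢ y k i i≢k)))))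

  twist-fSub : ∀ a b N c d → c * a ≅ b → c * d ^ N ≅ 1 → c * d ^ (p * N) ≅ 1 → twist c d (fSub p a N) ≈ fSub p b N
  twist-fSub a b N c d ca≅b cdᴺ≅1 cdᵖᴺ≅1 =
    ≈-trans (≋⇒≈ (twist-⊕ c d (mono a 0) (mono (p ∸ 1) N ⊕ mono 1 (p * N))))
    (⊕-cong≈ (twist-mono c d a 0 b (trans (cong (λ z → (c * z) % p) (*-identityˡ a)) ca≅b))
    (≈-trans (≋⇒≈ (twist-⊕ c d (mono (p ∸ 1) N) (mono 1 (p * N))))
    (⊕-cong≈ (twist-mono c d (p ∸ 1) N (p ∸ 1) (trans (cong (_% p) (sym (*-assoc c (d ^ N) (p ∸ 1))))
                                                    (trans (*-≅ cdᴺ≅1 refl) (cong (_% p) (*-identityˡ (p ∸ 1))))))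
             (twist-mono c d 1 (p * N) 1 (trans (cong (λ z → (c * z) % p) (*-identityʳ (d ^ (p * N)))) cdᵖᴺ≅1)))))

  p∣-twist : ∀ c d f i → p ∣ coeff f i → p ∣ coeff (twist c d f) i
  p∣-twist c d f i p∣fᵢ = subst (p ∣_) (sym (coeff-twist c d f i)) (∣n⇒∣m*n c (∣n⇒∣m*n (d ^ i) p∣fᵢ))

  p∤^ : ∀ {d} n → ¬ (p ∣ d) → ¬ (p ∣ d ^ n)
  p∤^ zero    p∤d p∣1   = p∤1 p∣1
  p∤^ {d} (suc n) p∤d p∣dⁿ⁺¹ with euclidsLemma d (d ^ n) p-prime p∣dⁿ⁺¹
  ... | inj₁ p∣d  = p∤d p∣d
  ... | inj₂ p∣dⁿ = p∤^ n p∤d p∣dⁿ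

  p∣-twist⁻¹ : ∀ {c d} → ¬ (p ∣ c) → ¬ (p ∣ d) → ∀ f i → p ∣ coeff (twist c d f) i → p ∣ coeff f i
  p∣-twist⁻¹ {c} {d} p∤c p∤d f i p∣twistᵢ
    with euclidsLemma c (d ^ i * coeff f i) p-prime (subst (p ∣_) (coeff-twist c d f i) p∣twistᵢ)
  ... | inj₁ p∣c = ⊥-elim (p∤c p∣c)
  ... | inj₂ p∣dⁱfᵢ with euclidsLemma (d ^ i) (coeff f i) p-prime p∣dⁱfᵢ
  ...   | inj₁ p∣dⁱ = ⊥-elim (p∤^ i p∤d p∣dⁱ)
  ...   | inj₂ p∣fᵢ = p∣fᵢ

  IsUnit-twist⁻¹ : ∀ {c d} → ¬ (p ∣ c) → ¬ (p ∣ d) → ∀ f → IsUnit p (twist c d f) → IsUnit p f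
  IsUnit-twist⁻¹ {c} {d} p∤c p∤d f (p∤twist₀ , p∣twistᵢ) =
    (λ p∣f₀ → p∤twist₀ (p∣-twist c d f 0 p∣f₀)) , λ i 1≤i → p∣-twist⁻¹ p∤c p∤d f i (p∣twistᵢ i 1≤i)

  -- A factorisation of f twists into a factorisation of g.
  Irreducible-twist⁻¹ : ∀ {c d f g} → ¬ (p ∣ c) → ¬ (p ∣ d) → twist c d f ≈ g → Irreducible p g → Irreducible p f
  Irreducible-twist⁻¹ {c} {d} {f} {g} p∤c p∤d twist≈g ((i , 1≤i , p∤gᵢ) , factors) = (i , 1≤i , p∤fᵢ) , factorsᶠ
    where
    p∤fᵢ : ¬ (p ∣ coeff f i)
    p∤fᵢ p∣fᵢ = p∤gᵢ (≅0⇒∣ (trans (sym (twist≈g .at≈ i)) (∣⇒≅0 (p∣-twist c d f i p∣fᵢ))))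
    factorsᶠ : ∀ a b → f ≈[ p ] (a ⊛ b) → IsUnit p a ⊎ IsUnit p b
    factorsᶠ a b f≈ab with factors (twist c d a) (twist 1 d b) (≈⇒≈[] g≈twists)
      where
      g≈twists : g ≈ (twist c d a ⊛ twist 1 d b)
      g≈twists = ≈-trans (≈-sym twist≈g)
                         (≈-trans (twist-cong≈ c d (≈[]⇒≈ {f} {a ⊛ b} f≈ab)) (≋⇒≈ (twist-⊛ c d a b)))
    ... | inj₁ unit-a = inj₁ (IsUnit-twist⁻¹ p∤c p∤d a unit-a)
    ... | inj₂ unit-b = inj₂ (IsUnit-twist⁻¹ p∤1 p∤d b unit-b)

  -- Take t = -a, c = t⁻¹ and d = tᵘ, an N-th root of t.
  fSub-twist : ∀ u N k → u * N ≡ 1 + k * (p ∸ 1) → ∀ a → 1 ≤ a → a ≤ p ∸ 1 →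
               Σ ℕ λ c → Σ ℕ λ d → ¬ (p ∣ c) × ¬ (p ∣ d) × twist c d (fSub p a N) ≈ fSub p (p ∸ 1) N
  fSub-twist u N k uN≡1+kP a 1≤a a≤p∸1 =
    c , d , p∤c , p∤^ u p∤t , twist-fSub a (p ∸ 1) N c d (*-complement≅-1 {c} {t} ct≅1 t+a≡p) cdᴺ≅1 cdᵖᴺ≅1
    where
    a<p : a < p
    a<p = ≤-<-trans a≤p∸1 (∸-monoʳ-< z<s (<⇒≤ 1<p))
    t : ℕ
    t = p ∸ a
    t+a≡p : t + a ≡ p
    t+a≡p = m∸n+n≡m (<⇒≤ a<p)
    t<p : t < p
    t<p = ∸-monoʳ-< 1≤a (<⇒≤ a<p)
    instance
      t≢0 : NonZero t
      t≢0 = >-nonZero (m<n⇒0<n∸m a<p)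
    p∤t : ¬ (p ∣ t)
    p∤t = p∤0<n<p (m<n⇒0<n∸m a<p) t<p
    inverse : Σ ℕ (λ c → c * t ≅ 1)
    inverse = coprime⇒invertible (Coprime.sym (prime⇒coprime p-prime t<p))
    c : ℕ
    c = proj₁ inverse
    ct≅1 : c * t ≅ 1
    ct≅1 = proj₂ inverse
    p∤c : ¬ (p ∣ c)
    p∤c p∣c = p∤1 (≅0⇒∣ (trans (sym ct≅1) (∣⇒≅0 (∣m⇒∣m*n t p∣c))))
    d : ℕ
    d = t ^ u
    dᴺ≅t : d ^ N ≅ t
    dᴺ≅t = Nth-root u N k uN≡1+kP t
    cdᴺ≅1 : c * d ^ N ≅ 1
    cdᴺ≅1 = trans (*-≅ˡ c dᴺ≅t) ct≅1
    cdᵖᴺ≅1 : c * d ^ (p * N) ≅ 1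
    cdᵖᴺ≅1 = trans (*-≅ˡ c (trans (cong (_% p) (trans (cong (d ^_) (*-comm p N)) (sym (^-*-assoc d N p))))
                                   (trans (fermat (d ^ N)) dᴺ≅t)))
                   ct≅1

prime∤⇒coprime : ∀ {ℓ n} → Prime ℓ → ¬ (ℓ ∣ n) → Coprime ℓ n
prime∤⇒coprime ℓ-prime ℓ∤n (d∣ℓ , d∣n) with prime⇒irreducible ℓ-prime d∣ℓ
... | inj₁ d≡1  = d≡1
... | inj₂ refl = ⊥-elim (ℓ∤n d∣n)

odd-prime⇒1<p∸1 : ∀ {p} → Prime p → ¬ (2 ∣ p) → 1 < p ∸ 1
odd-prime⇒1<p∸1 {p} p-prime p-odd = ∸-monoˡ-< (≤∧≢⇒< 2≤p 2≢p) (s≤s z≤n)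
  where
  2≤p : 2 ≤ p
  2≤p = nonTrivial⇒n>1 p ⦃ prime⇒nonTrivial p-prime ⦄
  2≢p : 2 ≢ p
  2≢p refl = p-odd ∣-refl

lemma5 : (p : ℕ) → Prime p → ¬ (2 ∣ p) →
         (e : ℕ) → IsOrder p (fSub p (p ∸ 1) 1) e →
         (ℓ : ℕ) → Prime ℓ → ℓ ∣ e →
         (m : ℕ) → Irreducible p (fSub p (p ∸ 1) (ℓ ^ m)) →
         (a : ℕ) → 1 ≤ a → a ≤ p ∸ 1 →
         Irreducible p (fSub p a (ℓ ^ m))
lemma5 p p-prime p-odd e order ℓ ℓ-prime ℓ∣e m irreducible a 1≤a a≤p∸1 =
  let (c , d , p∤c , p∤d , twist≈) = fSub-twist (u ^ m) (ℓ ^ m) (u ^ m * ℓ ^ m / (p ∸ 1)) uᵐℓᵐ≡1+kP a 1≤a a≤p∸1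
  in  Irreducible-twist⁻¹ p∤c p∤d twist≈ irreducible
  where
  open Twisting p p-prime
  instance
    p∸1≢0 : NonZero (p ∸ 1)
    p∸1≢0 = >-nonZero (<-trans z<s (odd-prime⇒1<p∸1 p-prime p-odd))
  module ModP∸1 = ModularArithmetic (p ∸ 1)
  ℓ∤p∸1 : ¬ (ℓ ∣ p ∸ 1)
  ℓ∤p∸1 = ArtinSchreier.prime∣order⇒∤p∸1 p p-prime order ℓ-prime ℓ∣e
  ℓ⁻¹ : Σ ℕ (λ u → ModP∸1._≅_ (u * ℓ) 1)
  ℓ⁻¹ = ModP∸1.coprime⇒invertible (prime∤⇒coprime ℓ-prime ℓ∤p∸1)
  u : ℕ
  u = proj₁ ℓ⁻¹
  uᵐℓᵐ≡1+kP : u ^ m * ℓ ^ m ≡ 1 + (u ^ m * ℓ ^ m / (p ∸ 1)) * (p ∸ 1)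
  uᵐℓᵐ≡1+kP = ModP∸1.≅1⇒≡1+[/]* (odd-prime⇒1<p∸1 p-prime p-odd) _ (ModP∸1.^-inverse m (proj₂ ℓ⁻¹))
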